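{- There are the following relations between the considered fragments: \begin{itemize} \item $\mathsf I(=) \nvdash \mathsf I(\ne), \mathsf I(\leqslant), \mathsf I(\not\leqslant)$, \item $\mathsf I(\ne) \nvdash \mathsf I(\leqslant), \mathsf I(\not\leqslant)$, \item $\mathsf I(\leqslant) \nvdash \mathsf I(=), \mathsf I(\ne), \mathsf I(\not\leqslant)$. \end{itemize}
   Context: $\mathsf Q$ denotes Robinson arithmetic in the language $(0, S, +, \cdot, \leqslant)$, with axioms $Sx \ne 0$, $Sx = Sy \rightarrow x = y$, $x \ne 0 \rightarrow \exists y (x = Sy)$, $x + 0 = x$, $x + Sy = S(x+y)$, $x \cdot 0 = 0$, $x \cdot Sy = x\cdot y + x$, $x \leqslant y \leftrightarrow \exists r (r + x = y)$. $\mathsf I(=)$ is $\mathsf Q$ together with the induction schema for all formulas of the form $t = s$ ($t,s$ arithmetic terms, possibly with parameters); $\mathsf I(\ne)$, $\mathsf I(\leqslant)$, $\mathsf I(\not\leqslant)$ are defined similarly with induction for formulas $t \ne s$, $t \leqslant s$, $\neg(t \leqslant s)$ respectively. -}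

module Defs where

open import Data.Nat using (ℕ; zero; suc)
open import Data.Fin using (Fin) renaming (zero to fz; suc to fs)
open import Data.List using (List; []; _∷_; map)
open import Data.List.Membership.Propositional using (_∈_)
open import Data.Product using (Σ; _×_; _,_)
open import Data.Sum using (_⊎_)
open import Relation.Binary.PropositionalEquality using (_≡_)
open import Relation.Nullary using (¬_)

infixl 6 _⊕_
infixl 7 _⊙_

data Term (n : ℕ) : Set where
  var : Fin n → Term n
  𝟘   : Term n
  S   : Term n → Term n
  _⊕_ : Term n → Term n → Term n
  _⊙_ : Term n → Term n → Term n

infix 4 _≐_ _≼_
infixr 3 _⇒_
infixr 4 _∨'_
infixr 5 _∧'_

data Fm (n : ℕ) : Set where
  _≐_  : Term n → Term n → Fm n
  _≼_  : Term n → Term n → Fm n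
  ⊥'   : Fm n
  _⇒_  : Fm n → Fm n → Fm n
  _∧'_ : Fm n → Fm n → Fm n
  _∨'_ : Fm n → Fm n → Fm n
  ∀'   : Fm (suc n) → Fm n
  ∃'   : Fm (suc n) → Fm n

¬' : ∀ {n} → Fm n → Fm n
¬' φ = φ ⇒ ⊥'

infix 2 _⇔'_
_⇔'_ : ∀ {n} → Fm n → Fm n → Fm n
φ ⇔' ψ = (φ ⇒ ψ) ∧' (ψ ⇒ φ)

Ren : ℕ → ℕ → Set
Ren n m = Fin n → Fin m

ext : ∀ {n m} → Ren n m → Ren (suc n) (suc m)
ext ρ fz     = fz
ext ρ (fs i) = fs (ρ i)

renT : ∀ {n m} → Ren n m → Term n → Term m
renT ρ (var i) = var (ρ i)
renT ρ 𝟘       = 𝟘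
renT ρ (S t)   = S (renT ρ t)
renT ρ (t ⊕ s) = renT ρ t ⊕ renT ρ s
renT ρ (t ⊙ s) = renT ρ t ⊙ renT ρ s

ren : ∀ {n m} → Ren n m → Fm n → Fm m
ren ρ (t ≐ s)  = renT ρ t ≐ renT ρ s
ren ρ (t ≼ s)  = renT ρ t ≼ renT ρ s
ren ρ ⊥'       = ⊥'
ren ρ (φ ⇒ ψ)  = ren ρ φ ⇒ ren ρ ψ
ren ρ (φ ∧' ψ) = ren ρ φ ∧' ren ρ ψ
ren ρ (φ ∨' ψ) = ren ρ φ ∨' ren ρ ψ
ren ρ (∀' φ)   = ∀' (ren (ext ρ) φ)
ren ρ (∃' φ)   = ∃' (ren (ext ρ) φ)

Sub : ℕ → ℕ → Set
Sub n m = Fin n → Term m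

exts : ∀ {n m} → Sub n m → Sub (suc n) (suc m)
exts σ fz     = var fz
exts σ (fs i) = renT fs (σ i)

subT : ∀ {n m} → Sub n m → Term n → Term m
subT σ (var i) = σ i
subT σ 𝟘       = 𝟘
subT σ (S t)   = S (subT σ t)
subT σ (t ⊕ s) = subT σ t ⊕ subT σ s
subT σ (t ⊙ s) = subT σ t ⊙ subT σ s

sub : ∀ {n m} → Sub n m → Fm n → Fm m
sub σ (t ≐ s)  = subT σ t ≐ subT σ s
sub σ (t ≼ s)  = subT σ t ≼ subT σ s
sub σ ⊥'       = ⊥'
sub σ (φ ⇒ ψ)  = sub σ φ ⇒ sub σ ψ
sub σ (φ ∧' ψ) = sub σ φ ∧' sub σ ψ
sub σ (φ ∨' ψ) = sub σ φ ∨' sub σ ψ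
sub σ (∀' φ)   = ∀' (sub (exts σ) φ)
sub σ (∃' φ)   = ∃' (sub (exts σ) φ)

single : ∀ {n} → Term n → Sub (suc n) n
single t fz     = t
single t (fs i) = var i

_[_] : ∀ {n} → Fm (suc n) → Term n → Fm n
φ [ t ] = sub (single t) φ

wk : ∀ {n} → Fm n → Fm (suc n)
wk = ren fs

wk0 : ∀ {n} → Fm 0 → Fm n
wk0 = ren (λ ())

close : ∀ {n} → Fm n → Fm 0
close {zero}  φ = φ
close {suc n} φ = close (∀' φ)

Theory : Set₁
Theory = Fm 0 → Set

data Der (T : Theory) {n : ℕ} (Γ : List (Fm n)) : Fm n → Set where
  hyp   : ∀ {φ} → φ ∈ Γ → Der T Γ φ
  ax    : ∀ {σ} → T σ → Der T Γ (wk0 σ)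
  raa   : ∀ {φ} → Der T (¬' φ ∷ Γ) ⊥' → Der T Γ φ
  ⇒I    : ∀ {φ ψ} → Der T (φ ∷ Γ) ψ → Der T Γ (φ ⇒ ψ)
  ⇒E    : ∀ {φ ψ} → Der T Γ (φ ⇒ ψ) → Der T Γ φ → Der T Γ ψ
  ∧I    : ∀ {φ ψ} → Der T Γ φ → Der T Γ ψ → Der T Γ (φ ∧' ψ)
  ∧E₁   : ∀ {φ ψ} → Der T Γ (φ ∧' ψ) → Der T Γ φ
  ∧E₂   : ∀ {φ ψ} → Der T Γ (φ ∧' ψ) → Der T Γ ψ
  ∨I₁   : ∀ {φ ψ} → Der T Γ φ → Der T Γ (φ ∨' ψ)
  ∨I₂   : ∀ {φ ψ} → Der T Γ ψ → Der T Γ (φ ∨' ψ)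
  ∨E    : ∀ {φ ψ χ} → Der T Γ (φ ∨' ψ) → Der T (φ ∷ Γ) χ → Der T (ψ ∷ Γ) χ → Der T Γ χ
  ∀I    : ∀ {φ} → Der T {suc n} (map wk Γ) φ → Der T Γ (∀' φ)
  ∀E    : ∀ {φ} → Der T Γ (∀' φ) → (t : Term n) → Der T Γ (φ [ t ])
  ∃I    : ∀ {φ} (t : Term n) → Der T Γ (φ [ t ]) → Der T Γ (∃' φ)
  ∃E    : ∀ {φ ψ} → Der T Γ (∃' φ) → Der T {suc n} (φ ∷ map wk Γ) (wk ψ) → Der T Γ ψ
  ≐refl : ∀ (t : Term n) → Der T Γ (t ≐ t)
  ≐subst : ∀ {φ : Fm (suc n)} {t s} → Der T Γ (t ≐ s) → Der T Γ (φ [ t ]) → Der T Γ (φ [ s ])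

_⊢_ : Theory → Fm 0 → Set
T ⊢ σ = Der T [] σ

_⊢ᵀ_ : Theory → Theory → Set
T ⊢ᵀ U = ∀ σ → U σ → T ⊢ σ

data QAx : Theory where
  q1 : QAx (∀' (¬' (S (var fz) ≐ 𝟘)))
  q2 : QAx (∀' (∀' (S (var (fs fz)) ≐ S (var fz) ⇒ var (fs fz) ≐ var fz)))
  q3 : QAx (∀' (¬' (var fz ≐ 𝟘) ⇒ ∃' (var (fs fz) ≐ S (var fz))))
  q4 : QAx (∀' (var fz ⊕ 𝟘 ≐ var fz))
  q5 : QAx (∀' (∀' (var (fs fz) ⊕ S (var fz) ≐ S (var (fs fz) ⊕ var fz))))
  q6 : QAx (∀' (var fz ⊙ 𝟘 ≐ 𝟘))
  q7 : QAx (∀' (∀' (var (fs fz) ⊙ S (var fz) ≐ var (fs fz) ⊙ var fz ⊕ var (fs fz))))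
  q8 : QAx (∀' (∀' (var (fs fz) ≼ var fz ⇔'
                    ∃' (var fz ⊕ var (fs (fs fz)) ≐ var (fs fz)))))

-- Induction axioms.  For φ with free variables 0 (the induction
-- variable) and 1..n (parameters), the instance is the universal
-- closure of  φ(0) ∧ ∀x (φ(x) → φ(Sx)) → ∀x φ(x).

succSub : ∀ {n} → Sub (suc n) (suc n)
succSub fz     = S (var fz)
succSub (fs i) = var (fs i)

indAx : ∀ {n} → Fm (suc n) → Fm 0
indAx φ = close ((φ [ 𝟘 ] ∧' ∀' (φ ⇒ sub succSub φ)) ⇒ ∀' φ)

data Kind : Set where
  eq neq le nle : Kind

atom : Kind → ∀ {n} → Term n → Term n → Fm n
atom eq  t s = t ≐ s
atom neq t s = ¬' (t ≐ s)
atom le  t s = t ≼ s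
atom nle t s = ¬' (t ≼ s)

data I (k : Kind) : Theory where
  base : ∀ {σ} → QAx σ → I k σ
  ind  : ∀ {n} (t s : Term (suc n)) → I k (indAx (atom k t s))

_⊬ᵀ_ : Theory → Theory → Set
T ⊬ᵀ U = ¬ (T ⊢ᵀ U)

module Submission where

-- Each non-derivability is witnessed by a model of Q in which the induction schema of
-- one fragment holds while an instance of the other fails.  Derivations are read
-- through the negative translation, so soundness needs no excluded middle.
--
-- ℕ ∪ {∞}: truncating all values at B is a homomorphism that cannot tell x = B from
-- x = ∞, so an equation or inequality between terms that holds at every numeral also
-- holds at ∞; this gives I(=) and I(≤).  But ∞ = S∞, refuting induction for x ≠ Sx
-- and for ¬ (Sx ≤ x).
--
-- ℕ ∪ {∞₁, ∞₂}: collapsing ∞₁ and ∞₂ is a homomorphism onto ℕ ∪ {∞} that preserves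
-- and reflects ≤, so I(≤) transfers; but 0 + ∞₁ = ∞₂ refutes induction for 0 + x = x.
--
-- Integer polynomials that are eventually nonnegative, up to eventual equality: a
-- term is a polynomial in the induction variable, so two terms agreeing at L
-- consecutive integers agree everywhere.  This gives I(=), taking the numerals
-- 0, …, L - 1, and I(≠), since by the contrapositive step an equality at a large a
-- propagates down to a - L, …, a.  But by parity X - x - x is never a numeral, so a
-- witness of x + x ≤ X leaves room for the next step, and induction for x + x ≤ X and
-- for ¬ (X ≤ x + x) fails at x = X.

open import Defs
open import Data.Fin using () renaming (zero to fz; suc to fs)
open import Data.Product using (_×_; _,_)

module Semantics where

  open import Data.Nat using (ℕ; zero; suc)
  open import Data.Fin using () renaming (zero to fz; suc to fs)
  open import Data.List using (List; []; _∷_; map)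
  open import Data.List.Relation.Unary.All as All using (All)
  open import Data.List.Relation.Unary.All.Properties using (map⁺)
  open import Data.Product using (Σ; _×_; _,_; proj₁; proj₂; map₂)
  open import Data.Product.Function.NonDependent.Propositional using (_×-⇔_)
  open import Data.Product.Function.Dependent.Propositional using (Σ-⇔)
  open import Data.Sum using (_⊎_; inj₁; inj₂; [_,_])
  open import Data.Sum.Function.Propositional using (_⊎-⇔_)
  open import Data.Empty using (⊥)
  open import Data.Vec.Functional using (Vector) renaming (_∷_ to _∷ᵥ_; [] to []ᵥ)
  open import Function using (_∘_; id; _⇔_; mk⇔; Equivalence)
  open import Function.Construct.Identity using (↠-id; ⇔-id)
  open import Function.Construct.Composition using (_⇔-∘_)
  open import Function.Related.TypeIsomorphisms using (→-cong-⇔; ¬-cong-⇔)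
  open import Relation.Binary.Structures using (IsEquivalence)
  open import Relation.Binary.PropositionalEquality as ≡ using (_≡_; refl; cong; cong₂)
  open import Relation.Nullary using (¬_)
  open import Relation.Nullary.Negation using (Stable; ¬¬-map; contradiction)

  open Equivalence using (to; from)

  private
    variable
      n m : ℕ

  record Structure : Set₁ where
    infix  4 _≈_
    infixl 6 _+_
    infixl 7 _*_
    field
      Carrier       : Set
      _≈_           : Carrier → Carrier → Set
      isEquivalence : IsEquivalence _≈_
      0#            : Carrier
      suc#          : Carrier → Carrier
      _+_ _*_       : Carrier → Carrier → Carrier
      suc-cong      : ∀ {x y} → x ≈ y → suc# x ≈ suc# y
      +-cong        : ∀ {x y u v} → x ≈ y → u ≈ v → x + u ≈ y + v
      *-cong        : ∀ {x y u v} → x ≈ y → u ≈ v → x * u ≈ y * v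

    open IsEquivalence isEquivalence public
      renaming (refl to ≈-refl; sym to ≈-sym; trans to ≈-trans)

  ≡-structure : (A : Set) → A → (A → A) → (A → A → A) → (A → A → A) → Structure
  ≡-structure A z s p t = record
    { Carrier = A ; _≈_ = _≡_ ; isEquivalence = ≡.isEquivalence
    ; 0# = z ; suc# = s ; _+_ = p ; _*_ = t
    ; suc-cong = cong s ; +-cong = cong₂ p ; *-cong = cong₂ t
    }

  ¬¬-⇔ : {A B : Set} → A ⇔ B → (¬ ¬ A) ⇔ (¬ ¬ B)
  ¬¬-⇔ = ¬-cong-⇔ ∘ ¬-cong-⇔

  Π-⇔ : {C : Set} {A B : C → Set} → (∀ c → A c ⇔ B c) → ((c : C) → A c) ⇔ ((c : C) → B c)
  Π-⇔ e = mk⇔ (λ f c → to (e c) (f c)) (λ g c → from (e c) (g c))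

  module Interpretation (𝔐 : Structure) where
    open Structure 𝔐 public

    Env : ℕ → Set
    Env = Vector Carrier

    ⟦_⟧ₜ : Term n → Env n → Carrier
    ⟦ var i ⟧ₜ ρ = ρ i
    ⟦ 𝟘 ⟧ₜ ρ     = 0#
    ⟦ S t ⟧ₜ ρ   = suc# (⟦ t ⟧ₜ ρ)
    ⟦ t ⊕ s ⟧ₜ ρ = ⟦ t ⟧ₜ ρ + ⟦ s ⟧ₜ ρ
    ⟦ t ⊙ s ⟧ₜ ρ = ⟦ t ⟧ₜ ρ * ⟦ s ⟧ₜ ρ

    infix 4 _≤ₘ_ _≋_
    _≤ₘ_ : Carrier → Carrier → Set
    a ≤ₘ b = Σ Carrier λ r → r + a ≈ b

    -- A negative translation (¬¬ on atoms, ∨ and ∃): every ⟦ φ ⟧ ρ is ¬¬-stable,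
    -- which is what makes raa sound.
    ⟦_⟧ : Fm n → Env n → Set
    ⟦ t ≐ s ⟧ ρ  = ¬ ¬ (⟦ t ⟧ₜ ρ ≈ ⟦ s ⟧ₜ ρ)
    ⟦ t ≼ s ⟧ ρ  = ¬ ¬ (⟦ t ⟧ₜ ρ ≤ₘ ⟦ s ⟧ₜ ρ)
    ⟦ ⊥' ⟧ ρ     = ⊥
    ⟦ φ ⇒ ψ ⟧ ρ  = ⟦ φ ⟧ ρ → ⟦ ψ ⟧ ρ
    ⟦ φ ∧' ψ ⟧ ρ = ⟦ φ ⟧ ρ × ⟦ ψ ⟧ ρ
    ⟦ φ ∨' ψ ⟧ ρ = ¬ ¬ (⟦ φ ⟧ ρ ⊎ ⟦ ψ ⟧ ρ)
    ⟦ ∀' φ ⟧ ρ   = ∀ d → ⟦ φ ⟧ (d ∷ᵥ ρ)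
    ⟦ ∃' φ ⟧ ρ   = ¬ ¬ (Σ Carrier λ d → ⟦ φ ⟧ (d ∷ᵥ ρ))

    ⟦⟧-stable : (φ : Fm n) (ρ : Env n) → Stable (⟦ φ ⟧ ρ)
    ⟦⟧-stable (t ≐ s) ρ h k  = h (contradiction k)
    ⟦⟧-stable (t ≼ s) ρ h k  = h (contradiction k)
    ⟦⟧-stable ⊥' ρ h         = h id
    ⟦⟧-stable (φ ⇒ ψ) ρ h a  = ⟦⟧-stable ψ ρ (¬¬-map (λ f → f a) h)
    ⟦⟧-stable (φ ∧' ψ) ρ h   = ⟦⟧-stable φ ρ (¬¬-map proj₁ h) , ⟦⟧-stable ψ ρ (¬¬-map proj₂ h)
    ⟦⟧-stable (φ ∨' ψ) ρ h k = h (contradiction k)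
    ⟦⟧-stable (∀' φ) ρ h d   = ⟦⟧-stable φ (d ∷ᵥ ρ) (¬¬-map (λ f → f d) h)
    ⟦⟧-stable (∃' φ) ρ h k   = h (contradiction k)

    _≋_ : Env n → Env n → Set
    ρ ≋ ρ' = ∀ i → ρ i ≈ ρ' i

    ∷-≋ : ∀ {ρ ρ' : Env n} {d d'} → d ≈ d' → ρ ≋ ρ' → (d ∷ᵥ ρ) ≋ (d' ∷ᵥ ρ')
    ∷-≋ e es fz     = e
    ∷-≋ e es (fs i) = es i

    ≋-refl : {ρ : Env n} → ρ ≋ ρ
    ≋-refl i = ≈-refl

    ⟦⟧ₜ-cong : (t : Term n) {ρ ρ' : Env n} → ρ ≋ ρ' → ⟦ t ⟧ₜ ρ ≈ ⟦ t ⟧ₜ ρ'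
    ⟦⟧ₜ-cong (var i) e = e i
    ⟦⟧ₜ-cong 𝟘 e       = ≈-refl
    ⟦⟧ₜ-cong (S t) e   = suc-cong (⟦⟧ₜ-cong t e)
    ⟦⟧ₜ-cong (t ⊕ s) e = +-cong (⟦⟧ₜ-cong t e) (⟦⟧ₜ-cong s e)
    ⟦⟧ₜ-cong (t ⊙ s) e = *-cong (⟦⟧ₜ-cong t e) (⟦⟧ₜ-cong s e)

    ≈-⇔ : ∀ {a a' b b'} → a ≈ a' → b ≈ b' → (a ≈ b) ⇔ (a' ≈ b')
    ≈-⇔ ea eb = mk⇔ (λ q → ≈-trans (≈-sym ea) (≈-trans q eb)) (λ q → ≈-trans ea (≈-trans q (≈-sym eb)))

    ≤ₘ-⇔ : ∀ {a a' b b'} → a ≈ a' → b ≈ b' → (a ≤ₘ b) ⇔ (a' ≤ₘ b')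
    ≤ₘ-⇔ ea eb = Σ-⇔ (↠-id _) (≈-⇔ (+-cong ≈-refl ea) eb)

    ⟦⟧-cong : (φ : Fm n) {ρ ρ' : Env n} → ρ ≋ ρ' → ⟦ φ ⟧ ρ ⇔ ⟦ φ ⟧ ρ'
    ⟦⟧-cong (t ≐ s) e  = ¬¬-⇔ (≈-⇔ (⟦⟧ₜ-cong t e) (⟦⟧ₜ-cong s e))
    ⟦⟧-cong (t ≼ s) e  = ¬¬-⇔ (≤ₘ-⇔ (⟦⟧ₜ-cong t e) (⟦⟧ₜ-cong s e))
    ⟦⟧-cong ⊥' e       = ⇔-id _
    ⟦⟧-cong (φ ⇒ ψ) e  = →-cong-⇔ (⟦⟧-cong φ e) (⟦⟧-cong ψ e)
    ⟦⟧-cong (φ ∧' ψ) e = ⟦⟧-cong φ e ×-⇔ ⟦⟧-cong ψ e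
    ⟦⟧-cong (φ ∨' ψ) e = ¬¬-⇔ (⟦⟧-cong φ e ⊎-⇔ ⟦⟧-cong ψ e)
    ⟦⟧-cong (∀' φ) e   = Π-⇔ λ d → ⟦⟧-cong φ (∷-≋ ≈-refl e)
    ⟦⟧-cong (∃' φ) e   = ¬¬-⇔ (Σ-⇔ (↠-id _) (⟦⟧-cong φ (∷-≋ ≈-refl e)))

    ren-⟦⟧ₜ : (t : Term n) (r : Ren n m) {ρ : Env m} {ρ' : Env n} →
              (∀ i → ρ (r i) ≈ ρ' i) → ⟦ renT r t ⟧ₜ ρ ≈ ⟦ t ⟧ₜ ρ'
    ren-⟦⟧ₜ (var i) r e = e i
    ren-⟦⟧ₜ 𝟘 r e       = ≈-refl
    ren-⟦⟧ₜ (S t) r e   = suc-cong (ren-⟦⟧ₜ t r e)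
    ren-⟦⟧ₜ (t ⊕ s) r e = +-cong (ren-⟦⟧ₜ t r e) (ren-⟦⟧ₜ s r e)
    ren-⟦⟧ₜ (t ⊙ s) r e = *-cong (ren-⟦⟧ₜ t r e) (ren-⟦⟧ₜ s r e)

    ext-≋ : (r : Ren n m) {ρ : Env m} {ρ' : Env n} → (∀ i → ρ (r i) ≈ ρ' i) →
            ∀ d i → (d ∷ᵥ ρ) (ext r i) ≈ (d ∷ᵥ ρ') i
    ext-≋ r e d fz     = ≈-refl
    ext-≋ r e d (fs i) = e i

    ren-⟦⟧ : (φ : Fm n) (r : Ren n m) {ρ : Env m} {ρ' : Env n} →
             (∀ i → ρ (r i) ≈ ρ' i) → ⟦ ren r φ ⟧ ρ ⇔ ⟦ φ ⟧ ρ'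
    ren-⟦⟧ (t ≐ s) r e  = ¬¬-⇔ (≈-⇔ (ren-⟦⟧ₜ t r e) (ren-⟦⟧ₜ s r e))
    ren-⟦⟧ (t ≼ s) r e  = ¬¬-⇔ (≤ₘ-⇔ (ren-⟦⟧ₜ t r e) (ren-⟦⟧ₜ s r e))
    ren-⟦⟧ ⊥' r e       = ⇔-id _
    ren-⟦⟧ (φ ⇒ ψ) r e  = →-cong-⇔ (ren-⟦⟧ φ r e) (ren-⟦⟧ ψ r e)
    ren-⟦⟧ (φ ∧' ψ) r e = ren-⟦⟧ φ r e ×-⇔ ren-⟦⟧ ψ r e
    ren-⟦⟧ (φ ∨' ψ) r e = ¬¬-⇔ (ren-⟦⟧ φ r e ⊎-⇔ ren-⟦⟧ ψ r e)
    ren-⟦⟧ (∀' φ) r e   = Π-⇔ λ d → ren-⟦⟧ φ (ext r) (ext-≋ r e d)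
    ren-⟦⟧ (∃' φ) r e   = ¬¬-⇔ (Σ-⇔ (↠-id _) (ren-⟦⟧ φ (ext r) (ext-≋ r e _)))

    sub-⟦⟧ₜ : (t : Term n) (σ : Sub n m) {ρ : Env m} {ρ' : Env n} →
              (∀ i → ⟦ σ i ⟧ₜ ρ ≈ ρ' i) → ⟦ subT σ t ⟧ₜ ρ ≈ ⟦ t ⟧ₜ ρ'
    sub-⟦⟧ₜ (var i) σ e = e i
    sub-⟦⟧ₜ 𝟘 σ e       = ≈-refl
    sub-⟦⟧ₜ (S t) σ e   = suc-cong (sub-⟦⟧ₜ t σ e)
    sub-⟦⟧ₜ (t ⊕ s) σ e = +-cong (sub-⟦⟧ₜ t σ e) (sub-⟦⟧ₜ s σ e)
    sub-⟦⟧ₜ (t ⊙ s) σ e = *-cong (sub-⟦⟧ₜ t σ e) (sub-⟦⟧ₜ s σ e)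

    exts-≋ : (σ : Sub n m) {ρ : Env m} {ρ' : Env n} → (∀ i → ⟦ σ i ⟧ₜ ρ ≈ ρ' i) →
             ∀ d i → ⟦ exts σ i ⟧ₜ (d ∷ᵥ ρ) ≈ (d ∷ᵥ ρ') i
    exts-≋ σ e d fz     = ≈-refl
    exts-≋ σ e d (fs i) = ≈-trans (ren-⟦⟧ₜ (σ i) fs λ _ → ≈-refl) (e i)

    sub-⟦⟧ : (φ : Fm n) (σ : Sub n m) {ρ : Env m} {ρ' : Env n} →
             (∀ i → ⟦ σ i ⟧ₜ ρ ≈ ρ' i) → ⟦ sub σ φ ⟧ ρ ⇔ ⟦ φ ⟧ ρ'
    sub-⟦⟧ (t ≐ s) σ e  = ¬¬-⇔ (≈-⇔ (sub-⟦⟧ₜ t σ e) (sub-⟦⟧ₜ s σ e))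
    sub-⟦⟧ (t ≼ s) σ e  = ¬¬-⇔ (≤ₘ-⇔ (sub-⟦⟧ₜ t σ e) (sub-⟦⟧ₜ s σ e))
    sub-⟦⟧ ⊥' σ e       = ⇔-id _
    sub-⟦⟧ (φ ⇒ ψ) σ e  = →-cong-⇔ (sub-⟦⟧ φ σ e) (sub-⟦⟧ ψ σ e)
    sub-⟦⟧ (φ ∧' ψ) σ e = sub-⟦⟧ φ σ e ×-⇔ sub-⟦⟧ ψ σ e
    sub-⟦⟧ (φ ∨' ψ) σ e = ¬¬-⇔ (sub-⟦⟧ φ σ e ⊎-⇔ sub-⟦⟧ ψ σ e)
    sub-⟦⟧ (∀' φ) σ e   = Π-⇔ λ d → sub-⟦⟧ φ (exts σ) (exts-≋ σ e d)
    sub-⟦⟧ (∃' φ) σ e   = ¬¬-⇔ (Σ-⇔ (↠-id _) (sub-⟦⟧ φ (exts σ) (exts-≋ σ e _)))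

    wk-⟦⟧ : (φ : Fm n) {ρ : Env n} {d : Carrier} → ⟦ wk φ ⟧ (d ∷ᵥ ρ) ⇔ ⟦ φ ⟧ ρ
    wk-⟦⟧ φ = ren-⟦⟧ φ fs λ _ → ≈-refl

    wk0-⟦⟧ : (σ : Fm 0) {ρ : Env n} → ⟦ wk0 σ ⟧ ρ ⇔ ⟦ σ ⟧ []ᵥ
    wk0-⟦⟧ σ = ren-⟦⟧ σ (λ ()) λ ()

    single-≋ : (t : Term n) {ρ : Env n} → ∀ i → ⟦ single t i ⟧ₜ ρ ≈ (⟦ t ⟧ₜ ρ ∷ᵥ ρ) i
    single-≋ t fz     = ≈-refl
    single-≋ t (fs i) = ≈-refl

    []-⟦⟧ : (φ : Fm (suc n)) (t : Term n) {ρ : Env n} → ⟦ φ [ t ] ⟧ ρ ⇔ ⟦ φ ⟧ (⟦ t ⟧ₜ ρ ∷ᵥ ρ)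
    []-⟦⟧ φ t = sub-⟦⟧ φ (single t) (single-≋ t)

    succSub-≋ : {ρ : Env n} (d : Carrier) → ∀ i → ⟦ succSub i ⟧ₜ (d ∷ᵥ ρ) ≈ (suc# d ∷ᵥ ρ) i
    succSub-≋ d fz     = ≈-refl
    succSub-≋ d (fs i) = ≈-refl

    Holds : List (Fm n) → Env n → Set
    Holds Γ ρ = All (λ ψ → ⟦ ψ ⟧ ρ) Γ

    Holds-wk : ∀ {Γ : List (Fm n)} {ρ} d → Holds Γ ρ → Holds (map wk Γ) (d ∷ᵥ ρ)
    Holds-wk d = map⁺ ∘ All.map λ {ψ} → from (wk-⟦⟧ ψ)

    Models : Theory → Set
    Models T = ∀ {σ} → T σ → ⟦ σ ⟧ []ᵥ

    sound : ∀ {T} {Γ : List (Fm n)} {φ} → Models T → Der T Γ φ → ∀ ρ → Holds Γ ρ → ⟦ φ ⟧ ρ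
    sound ⊨T (hyp p) ρ γ                 = All.lookup γ p
    sound ⊨T (ax {σ} p) ρ γ              = from (wk0-⟦⟧ σ) (⊨T p)
    sound ⊨T (raa {φ} d) ρ γ             = ⟦⟧-stable φ ρ λ ¬φ → sound ⊨T d ρ (¬φ All.∷ γ)
    sound ⊨T (⇒I d) ρ γ a                = sound ⊨T d ρ (a All.∷ γ)
    sound ⊨T (⇒E d e) ρ γ                = sound ⊨T d ρ γ (sound ⊨T e ρ γ)
    sound ⊨T (∧I d e) ρ γ                = sound ⊨T d ρ γ , sound ⊨T e ρ γ
    sound ⊨T (∧E₁ d) ρ γ                 = proj₁ (sound ⊨T d ρ γ)
    sound ⊨T (∧E₂ d) ρ γ                 = proj₂ (sound ⊨T d ρ γ)
    sound ⊨T (∨I₁ d) ρ γ                 = contradiction (inj₁ (sound ⊨T d ρ γ))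
    sound ⊨T (∨I₂ d) ρ γ                 = contradiction (inj₂ (sound ⊨T d ρ γ))
    sound ⊨T (∨E {χ = χ} d e f) ρ γ      = ⟦⟧-stable χ ρ (¬¬-map
      [ (λ a → sound ⊨T e ρ (a All.∷ γ)) , (λ b → sound ⊨T f ρ (b All.∷ γ)) ] (sound ⊨T d ρ γ))
    sound ⊨T (∀I d) ρ γ x                = sound ⊨T d (x ∷ᵥ ρ) (Holds-wk x γ)
    sound ⊨T (∀E {φ} d t) ρ γ            = from ([]-⟦⟧ φ t) (sound ⊨T d ρ γ _)
    sound ⊨T (∃I {φ} t d) ρ γ            = contradiction (_ , to ([]-⟦⟧ φ t) (sound ⊨T d ρ γ))
    sound ⊨T (∃E {ψ = ψ} d e) ρ γ        = ⟦⟧-stable ψ ρ (¬¬-map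
      (λ (x , p) → to (wk-⟦⟧ ψ) (sound ⊨T e (x ∷ᵥ ρ) (p All.∷ Holds-wk x γ))) (sound ⊨T d ρ γ))
    sound ⊨T (≐refl t) ρ γ               = contradiction ≈-refl
    sound ⊨T (≐subst {φ} {t} {s} d e) ρ γ = from ([]-⟦⟧ φ s) (⟦⟧-stable φ _ (¬¬-map
      (λ t≈s → to (⟦⟧-cong φ (∷-≋ t≈s ≋-refl)) (to ([]-⟦⟧ φ t) (sound ⊨T e ρ γ))) (sound ⊨T d ρ γ)))

    countermodel : ∀ {T U σ} → Models T → U σ → ¬ ⟦ σ ⟧ []ᵥ → T ⊬ᵀ U
    countermodel ⊨T uσ ⊭σ T⊢U = ⊭σ (sound ⊨T (T⊢U _ uσ) []ᵥ All.[])

    InductionHolds : Fm (suc n) → Set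
    InductionHolds {n} φ = ∀ (ρ : Env n) → ⟦ φ ⟧ (0# ∷ᵥ ρ) →
      (∀ d → ⟦ φ ⟧ (d ∷ᵥ ρ) → ⟦ φ ⟧ (suc# d ∷ᵥ ρ)) → ∀ d → ⟦ φ ⟧ (d ∷ᵥ ρ)

    close-⟦⟧ : (φ : Fm n) → (∀ ρ → ⟦ φ ⟧ ρ) → ⟦ close φ ⟧ []ᵥ
    close-⟦⟧ {zero} φ h  = h []ᵥ
    close-⟦⟧ {suc n} φ h = close-⟦⟧ (∀' φ) λ ρ d → h (d ∷ᵥ ρ)

    indAx-⟦⟧ : (φ : Fm (suc n)) → InductionHolds φ → ⟦ indAx φ ⟧ []ᵥ
    indAx-⟦⟧ {n} φ holds = close-⟦⟧ {n} _ λ ρ (φ₀ , φₛ) → holds ρ (to ([]-⟦⟧ φ 𝟘) φ₀)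
      λ d p → to (sub-⟦⟧ φ succSub (succSub-≋ d)) (φₛ d p)

    models-I : ∀ {k} → Models QAx → (∀ {n} (t s : Term (suc n)) → InductionHolds (atom k t s)) → Models (I k)
    models-I ⊨Q holds (base q)  = ⊨Q q
    models-I ⊨Q holds (ind t s) = indAx-⟦⟧ _ (holds t s)

    numeral : ℕ → Carrier
    numeral zero    = 0#
    numeral (suc j) = suc# (numeral j)

    induction-numerals : (φ : Fm (suc n)) {ρ : Env n} → ⟦ φ ⟧ (0# ∷ᵥ ρ) →
      (∀ d → ⟦ φ ⟧ (d ∷ᵥ ρ) → ⟦ φ ⟧ (suc# d ∷ᵥ ρ)) → ∀ j → ⟦ φ ⟧ (numeral j ∷ᵥ ρ)
    induction-numerals φ φ₀ φₛ zero    = φ₀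
    induction-numerals φ φ₀ φₛ (suc j) = φₛ _ (induction-numerals φ φ₀ φₛ j)

    record QLaws : Set where
      field
        suc-≉-0       : ∀ x → ¬ suc# x ≈ 0#
        suc-injective : ∀ {x y} → suc# x ≈ suc# y → x ≈ y
        predecessor   : ∀ x → ¬ x ≈ 0# → Σ Carrier λ y → x ≈ suc# y
        +-identityʳ   : ∀ x → x + 0# ≈ x
        +-suc         : ∀ x y → x + suc# y ≈ suc# (x + y)
        *-zeroʳ       : ∀ x → x * 0# ≈ 0#
        *-suc         : ∀ x y → x * suc# y ≈ x * y + x

    module _ (laws : QLaws) where
      open QLaws laws

      models-Q : Models QAx
      models-Q q1 x     = contradiction (suc-≉-0 x)
      models-Q q2 x y   = ¬¬-map suc-injective
      models-Q q3 x x≉0 = contradiction (map₂ contradiction (predecessor x (x≉0 ∘ contradiction)))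
      models-Q q4 x     = contradiction (+-identityʳ x)
      models-Q q5 x y   = contradiction (+-suc x y)
      models-Q q6 x     = contradiction (*-zeroʳ x)
      models-Q q7 x y   = contradiction (*-suc x y)
      models-Q q8 x y   = ¬¬-map (map₂ contradiction) , λ h k → h λ (r , e) → e (k ∘ (r ,_))

      ¬induction-x≉Sx : ∀ ω → ω ≈ suc# ω → ¬ ⟦ indAx {0} (atom neq (var fz) (S (var fz))) ⟧ []ᵥ
      ¬induction-x≉Sx ω ω≈Sω induction = induction
        ( (λ 0≈1 → 0≈1 λ e → suc-≉-0 0# (≈-sym e))
        , λ d d≉Sd → d≉Sd ∘ ¬¬-map suc-injective )
        ω (contradiction ω≈Sω)

      ¬induction-Sx≰x : ∀ ω → suc# ω ≤ₘ ω → ¬ ⟦ indAx {0} (atom nle (S (var fz)) (var fz)) ⟧ []ᵥ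
      ¬induction-Sx≰x ω Sω≤ω induction = induction
        ( (λ 1≤0 → 1≤0 λ (r , e) → suc-≉-0 (r + 0#) (≈-trans (≈-sym (+-suc r 0#)) e))
        , λ d Sd≰d → Sd≰d ∘ ¬¬-map λ (r , e) → r , suc-injective (≈-trans (≈-sym (+-suc r _)) e) )
        ω (contradiction Sω≤ω)

      ¬induction-0+x≈x : ∀ a → ¬ 0# + a ≈ a → ¬ ⟦ indAx {0} (atom eq (𝟘 ⊕ var fz) (var fz)) ⟧ []ᵥ
      ¬induction-0+x≈x a 0+a≉a induction = induction
        ( contradiction (+-identityʳ 0#)
        , λ d → ¬¬-map λ e → ≈-trans (+-suc 0# d) (suc-cong e) )
        a 0+a≉a

  module Homomorphism (𝔐 𝔑 : Structure) where
    private
      module M = Interpretation 𝔐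
      module N = Interpretation 𝔑

    record IsHomomorphism (h : M.Carrier → N.Carrier) : Set where
      field
        0-hom   : h M.0# N.≈ N.0#
        suc-hom : ∀ x → h (M.suc# x) N.≈ N.suc# (h x)
        +-hom   : ∀ x y → h (x M.+ y) N.≈ h x N.+ h y
        *-hom   : ∀ x y → h (x M.* y) N.≈ h x N.* h y

    module _ {h : M.Carrier → N.Carrier} (hom : IsHomomorphism h) where
      open IsHomomorphism hom

      ⟦⟧ₜ-hom : (t : Term n) (ρ : M.Env n) → h (M.⟦ t ⟧ₜ ρ) N.≈ N.⟦ t ⟧ₜ (h ∘ ρ)
      ⟦⟧ₜ-hom (var i) ρ = N.≈-refl
      ⟦⟧ₜ-hom 𝟘 ρ       = 0-hom
      ⟦⟧ₜ-hom (S t) ρ   = N.≈-trans (suc-hom _) (N.suc-cong (⟦⟧ₜ-hom t ρ))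
      ⟦⟧ₜ-hom (t ⊕ s) ρ = N.≈-trans (+-hom _ _) (N.+-cong (⟦⟧ₜ-hom t ρ) (⟦⟧ₜ-hom s ρ))
      ⟦⟧ₜ-hom (t ⊙ s) ρ = N.≈-trans (*-hom _ _) (N.*-cong (⟦⟧ₜ-hom t ρ) (⟦⟧ₜ-hom s ρ))

      ≼-transfer : (∀ {u v} → (u M.≤ₘ v) ⇔ (h u N.≤ₘ h v)) →
                   (t s : Term n) (ρ : M.Env n) → M.⟦ t ≼ s ⟧ ρ ⇔ N.⟦ t ≼ s ⟧ (h ∘ ρ)
      ≼-transfer ≤ₘ-⇔ t s ρ = ¬¬-⇔ (N.≤ₘ-⇔ (⟦⟧ₜ-hom t ρ) (⟦⟧ₜ-hom s ρ) ⇔-∘ ≤ₘ-⇔)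

module ℕ∞-Model where

  open Semantics
  open import Data.Nat using (ℕ; zero; suc; _+_; _*_; _∸_; _⊓_; _⊔_; _≤_; _<_; z≤n; s≤s; _≤?_)
  open import Data.Nat.Properties
  open import Data.Fin using () renaming (zero to fz; suc to fs)
  open import Data.Product using (Σ; _,_)
  open import Data.Sum using (inj₁; inj₂)
  open import Data.Vec.Functional using () renaming (_∷_ to _∷ᵥ_; [] to []ᵥ)
  open import Function using (_∘_)
  open import Relation.Binary.PropositionalEquality using (_≡_; refl; sym; trans; cong; subst; subst₂; module ≡-Reasoning)
  open import Relation.Nullary using (¬_; yes; no)
  open import Relation.Nullary.Negation using (¬¬-map; contradiction)

  data ℕ∞ : Set where
    fin : ℕ → ℕ∞
    ∞   : ℕ∞

  suc∞ : ℕ∞ → ℕ∞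
  suc∞ (fin a) = fin (suc a)
  suc∞ ∞       = ∞

  infixl 6 _+∞_
  infixl 7 _*∞_

  _+∞_ : ℕ∞ → ℕ∞ → ℕ∞
  fin a +∞ fin b = fin (a + b)
  fin a +∞ ∞     = ∞
  ∞     +∞ y     = ∞

  -- ∞ · 0 = 0 is forced by x · 0 = 0.
  _*∞_ : ℕ∞ → ℕ∞ → ℕ∞
  fin a       *∞ fin b       = fin (a * b)
  fin zero    *∞ ∞           = fin zero
  fin (suc a) *∞ ∞           = ∞
  ∞           *∞ fin zero    = fin zero
  ∞           *∞ fin (suc b) = ∞
  ∞           *∞ ∞           = ∞

  ℕ∞-structure : Structure
  ℕ∞-structure = ≡-structure ℕ∞ (fin 0) suc∞ _+∞_ _*∞_

  open Interpretation ℕ∞-structure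
    hiding (_+_; _*_)

  ∞-predecessor : ∀ x → ¬ x ≡ fin 0 → Σ ℕ∞ λ y → x ≡ suc∞ y
  ∞-predecessor (fin zero) x≢0    = contradiction refl x≢0
  ∞-predecessor (fin (suc a)) _   = fin a , refl
  ∞-predecessor ∞ _               = ∞ , refl

  +∞-suc : ∀ x y → x +∞ suc∞ y ≡ suc∞ (x +∞ y)
  +∞-suc (fin a) (fin b) = cong fin (+-suc a b)
  +∞-suc (fin a) ∞       = refl
  +∞-suc ∞ y             = refl

  *∞-suc : ∀ x y → x *∞ suc∞ y ≡ x *∞ y +∞ x
  *∞-suc (fin a) (fin b)       = cong fin (trans (*-suc a b) (+-comm a (a * b)))
  *∞-suc (fin zero) ∞          = refl
  *∞-suc (fin (suc a)) ∞       = refl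
  *∞-suc ∞ (fin zero)          = refl
  *∞-suc ∞ (fin (suc b))       = refl
  *∞-suc ∞ ∞                   = refl

  ℕ∞-QLaws : QLaws
  ℕ∞-QLaws = record
    { suc-≉-0       = λ { (fin a) () ; ∞ () }
    ; suc-injective = λ { {fin a} {fin .a} refl → refl ; {∞} {∞} refl → refl }
    ; predecessor   = ∞-predecessor
    ; +-identityʳ   = λ { (fin a) → cong fin (+-identityʳ a) ; ∞ → refl }
    ; +-suc         = +∞-suc
    ; *-zeroʳ       = λ { (fin a) → cong fin (*-zeroʳ a) ; ∞ → refl }
    ; *-suc         = *∞-suc
    }

  truncated : ℕ → Structure
  truncated B = ≡-structure ℕ 0 (λ a → suc a ⊓ B) (λ a b → (a + b) ⊓ B) (λ a b → (a * b) ⊓ B)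

  cap : ℕ → ℕ∞ → ℕ
  cap B (fin a) = a ⊓ B
  cap B ∞       = B

  ⊓-both-≥ : ∀ {B x y} → B ≤ x → B ≤ y → x ⊓ B ≡ y ⊓ B
  ⊓-both-≥ B≤x B≤y = trans (m≥n⇒m⊓n≡n B≤x) (sym (m≥n⇒m⊓n≡n B≤y))

  ⊓-suc : ∀ a B → suc a ⊓ B ≡ suc (a ⊓ B) ⊓ B
  ⊓-suc a B with ≤-total a B
  ... | inj₁ a≤B rewrite m≤n⇒m⊓n≡m a≤B = refl
  ... | inj₂ B≤a rewrite m≥n⇒m⊓n≡n B≤a = ⊓-both-≥ (m≤n⇒m≤1+n B≤a) (n≤1+n B)

  ⊓-+ : ∀ a b B → (a + b) ⊓ B ≡ (a ⊓ B + b ⊓ B) ⊓ B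
  ⊓-+ a b B with ≤-total a B | ≤-total b B
  ... | inj₁ a≤B | inj₁ b≤B rewrite m≤n⇒m⊓n≡m a≤B | m≤n⇒m⊓n≡m b≤B = refl
  ... | inj₂ B≤a | _ rewrite m≥n⇒m⊓n≡n B≤a = ⊓-both-≥ (≤-trans B≤a (m≤m+n a b)) (m≤m+n B _)
  ... | inj₁ _ | inj₂ B≤b rewrite m≥n⇒m⊓n≡n B≤b = ⊓-both-≥ (≤-trans B≤b (m≤n+m b a)) (m≤n+m B _)

  ≤-*-suc⊓ : ∀ B c → B ≤ B * (suc c ⊓ B)
  ≤-*-suc⊓ zero c    = z≤n
  ≤-*-suc⊓ (suc B) c = m≤m*n (suc B) (suc (c ⊓ B))

  ⊓-*-large : ∀ a b B → B ≤ a → (a * b) ⊓ B ≡ ((a ⊓ B) * (b ⊓ B)) ⊓ B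
  ⊓-*-large a zero B B≤a rewrite *-zeroʳ a | *-zeroʳ (a ⊓ B) = refl
  ⊓-*-large a (suc b) B B≤a rewrite m≥n⇒m⊓n≡n B≤a =
    ⊓-both-≥ (≤-trans B≤a (m≤m*n a (suc b))) (≤-*-suc⊓ B b)

  ⊓-* : ∀ a b B → (a * b) ⊓ B ≡ ((a ⊓ B) * (b ⊓ B)) ⊓ B
  ⊓-* a b B with ≤-total a B | ≤-total b B
  ... | inj₁ a≤B | inj₁ b≤B rewrite m≤n⇒m⊓n≡m a≤B | m≤n⇒m⊓n≡m b≤B = refl
  ... | inj₂ B≤a | _ = ⊓-*-large a b B B≤a
  ... | inj₁ _ | inj₂ B≤b rewrite *-comm a b | *-comm (a ⊓ B) (b ⊓ B) = ⊓-*-large b a B B≤b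

  ≤-*-self : ∀ B → B ≤ B * B
  ≤-*-self zero    = z≤n
  ≤-*-self (suc B) = m≤m*n (suc B) (suc B)

  module _ (B : ℕ) where
    open Homomorphism ℕ∞-structure (truncated B)

    cap-isHomomorphism : IsHomomorphism (cap B)
    cap-isHomomorphism = record
      { 0-hom   = refl
      ; suc-hom = λ { (fin a) → ⊓-suc a B ; ∞ → sym (m≥n⇒m⊓n≡n (n≤1+n B)) }
      ; +-hom   = +-hom
      ; *-hom   = *-hom
      }
      where
        +-hom : ∀ x y → cap B (x +∞ y) ≡ (cap B x + cap B y) ⊓ B
        +-hom (fin a) (fin b) = ⊓-+ a b B
        +-hom (fin a) ∞       = sym (m≥n⇒m⊓n≡n (m≤n+m B (a ⊓ B)))
        +-hom ∞ y             = sym (m≥n⇒m⊓n≡n (m≤m+n B (cap B y)))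
        *-hom : ∀ x y → cap B (x *∞ y) ≡ (cap B x * cap B y) ⊓ B
        *-hom (fin a) (fin b)       = ⊓-* a b B
        *-hom (fin zero) ∞          = refl
        *-hom (fin (suc a)) ∞       = sym (m≥n⇒m⊓n≡n (subst (B ≤_) (*-comm B _) (≤-*-suc⊓ B a)))
        *-hom ∞ (fin zero)          = cong (_⊓ B) (sym (*-zeroʳ B))
        *-hom ∞ (fin (suc b))       = sym (m≥n⇒m⊓n≡n (≤-*-suc⊓ B b))
        *-hom ∞ ∞                   = sym (m≥n⇒m⊓n≡n (≤-*-self B))

  cap-fin≡cap-∞ : ∀ {n} (t : Term (suc n)) (ρ : Env n) B →
                  cap B (⟦ t ⟧ₜ (fin B ∷ᵥ ρ)) ≡ cap B (⟦ t ⟧ₜ (∞ ∷ᵥ ρ))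
  cap-fin≡cap-∞ t ρ B = begin
    cap B (⟦ t ⟧ₜ (fin B ∷ᵥ ρ))    ≡⟨ ⟦⟧ₜ-hom (cap-isHomomorphism B) t _ ⟩
    T.⟦ t ⟧ₜ (cap B ∘ (fin B ∷ᵥ ρ)) ≡⟨ T.⟦⟧ₜ-cong t (λ { fz → ⊓-idem B ; (fs i) → refl }) ⟩
    T.⟦ t ⟧ₜ (cap B ∘ (∞ ∷ᵥ ρ))     ≡⟨ ⟦⟧ₜ-hom (cap-isHomomorphism B) t _ ⟨
    cap B (⟦ t ⟧ₜ (∞ ∷ᵥ ρ))        ∎
    where
      open ≡-Reasoning
      open Homomorphism ℕ∞-structure (truncated B)
      module T = Interpretation (truncated B)

  cap-below : ∀ {a B} → a < B → cap B (fin a) ≡ a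
  cap-below a<B = m≤n⇒m⊓n≡m (<⇒≤ a<B)

  caps-determine-≡ : ∀ u v → (∀ B → ¬ ¬ cap B u ≡ cap B v) → ¬ ¬ u ≡ v
  caps-determine-≡ (fin a) (fin b) caps = ¬¬-map (λ e → cong fin (begin
      a                       ≡⟨ cap-below (s≤s (m≤m⊔n a b)) ⟨
      cap (suc (a ⊔ b)) (fin a) ≡⟨ e ⟩
      cap (suc (a ⊔ b)) (fin b) ≡⟨ cap-below (s≤s (m≤n⊔m a b)) ⟩
      b                       ∎)) (caps (suc (a ⊔ b)))
    where open ≡-Reasoning
  caps-determine-≡ (fin a) ∞ caps _ = caps (suc a) λ e → <-irrefl (trans (sym (cap-below ≤-refl)) e) ≤-refl
  caps-determine-≡ ∞ (fin b) caps _ = caps (suc b) λ e → <-irrefl (trans (sym (cap-below ≤-refl)) (sym e)) ≤-refl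
  caps-determine-≡ ∞ ∞ caps       = contradiction refl

  cap-≤ : ∀ B u → cap B u ≤ B
  cap-≤ B (fin a) = m⊓n≤n a B
  cap-≤ B ∞       = ≤-refl

  cap-mono : ∀ B {u v} → u ≤ₘ v → cap B u ≤ cap B v
  cap-mono B {u} {∞} _                      = cap-≤ B u
  cap-mono B {fin a} {fin b} (fin c , refl) = ⊓-monoˡ-≤ B (m≤n+m a c)
  cap-mono B {∞} {fin b} (fin c , ())

  ⊓-suc-≤ : ∀ {a b} → a ⊓ suc b ≤ b → a ≤ b
  ⊓-suc-≤ {a} {b} a⊓b+1≤b with a ≤? b
  ... | yes a≤b = a≤b
  ... | no a≰b  = contradiction (subst (_≤ b) (m≥n⇒m⊓n≡n (≰⇒> a≰b)) a⊓b+1≤b) (<-irrefl refl)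

  caps-determine-≤ : ∀ u v → (∀ B → ¬ ¬ cap B u ≤ cap B v) → ¬ ¬ u ≤ₘ v
  caps-determine-≤ u ∞ caps               = contradiction (∞ , refl)
  caps-determine-≤ ∞ (fin b) caps _       = caps (suc b) λ b+1≤cap →
    <-irrefl refl (subst (suc b ≤_) (cap-below ≤-refl) b+1≤cap)
  caps-determine-≤ (fin a) (fin b) caps k = caps (suc b) λ cap≤cap →
    k (fin (b ∸ a) , cong fin (m∸n+n≡m (⊓-suc-≤ (subst (a ⊓ suc b ≤_) (cap-below ≤-refl) cap≤cap))))

  module _ {n} (t s : Term (suc n)) (ρ : Env n) where

    ≐-at-∞ : (∀ m → ⟦ t ≐ s ⟧ (fin m ∷ᵥ ρ)) → ⟦ t ≐ s ⟧ (∞ ∷ᵥ ρ)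
    ≐-at-∞ t≐s = caps-determine-≡ _ _ λ B → ¬¬-map
      (λ e → trans (sym (cap-fin≡cap-∞ t ρ B)) (trans (cong (cap B) e) (cap-fin≡cap-∞ s ρ B))) (t≐s B)

    ≼-at-∞ : (∀ m → ⟦ t ≼ s ⟧ (fin m ∷ᵥ ρ)) → ⟦ t ≼ s ⟧ (∞ ∷ᵥ ρ)
    ≼-at-∞ t≼s = caps-determine-≤ _ _ λ B → ¬¬-map
      (λ l → subst₂ _≤_ (cap-fin≡cap-∞ t ρ B) (cap-fin≡cap-∞ s ρ B) (cap-mono B l)) (t≼s B)

  numeral≡fin : ∀ m → numeral m ≡ fin m
  numeral≡fin zero    = refl
  numeral≡fin (suc m) = cong suc∞ (numeral≡fin m)

  induction-from-∞ : ∀ {n} (φ : Fm (suc n)) →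
    (∀ ρ → (∀ m → ⟦ φ ⟧ (fin m ∷ᵥ ρ)) → ⟦ φ ⟧ (∞ ∷ᵥ ρ)) → InductionHolds φ
  induction-from-∞ φ limit ρ φ₀ φₛ (fin m) =
    subst (λ d → ⟦ φ ⟧ (d ∷ᵥ ρ)) (numeral≡fin m) (induction-numerals φ φ₀ φₛ m)
  induction-from-∞ φ limit ρ φ₀ φₛ ∞       = limit ρ λ m → induction-from-∞ φ limit ρ φ₀ φₛ (fin m)

  ℕ∞-models-I= : Models (I eq)
  ℕ∞-models-I= = models-I (models-Q ℕ∞-QLaws) λ t s → induction-from-∞ (t ≐ s) (≐-at-∞ t s)

  ℕ∞-models-I≤ : Models (I le)
  ℕ∞-models-I≤ = models-I (models-Q ℕ∞-QLaws) λ t s → induction-from-∞ (t ≼ s) (≼-at-∞ t s)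

  ℕ∞-refutes-I≠ : ¬ ⟦ indAx {0} (atom neq (var fz) (S (var fz))) ⟧ []ᵥ
  ℕ∞-refutes-I≠ = ¬induction-x≉Sx ℕ∞-QLaws ∞ refl

  ℕ∞-refutes-I≰ : ¬ ⟦ indAx {0} (atom nle (S (var fz)) (var fz)) ⟧ []ᵥ
  ℕ∞-refutes-I≰ = ¬induction-Sx≰x ℕ∞-QLaws ∞ (∞ , refl)

module ℕ∞₂-Model where

  open Semantics
  open ℕ∞-Model using (ℕ∞; fin; ∞; _+∞_; _*∞_; ℕ∞-structure; ≼-at-∞)
  open import Data.Nat using (ℕ; zero; suc; _+_; _*_)
  open import Data.Nat.Properties using (+-identityʳ; +-suc; *-zeroʳ; *-suc; +-comm)
  open import Data.Fin using () renaming (zero to fz; suc to fs)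
  open import Data.Product using (Σ; _,_)
  open import Data.Vec.Functional using () renaming (_∷_ to _∷ᵥ_; [] to []ᵥ)
  open import Function using (_∘_; _⇔_; mk⇔; Equivalence)
  open import Function.Construct.Composition using (_⇔-∘_)
  open import Relation.Binary.PropositionalEquality using (_≡_; refl; sym; trans; cong; subst)
  open import Relation.Nullary using (¬_)
  open import Relation.Nullary.Negation using (contradiction)

  open Equivalence using (to; from)

  data ℕ∞₂ : Set where
    nat    : ℕ → ℕ∞₂
    ∞₁ ∞₂  : ℕ∞₂

  suc₂ : ℕ∞₂ → ℕ∞₂
  suc₂ (nat a) = nat (suc a)
  suc₂ x       = x

  infixl 6 _+₂_
  infixl 7 _*₂_

  -- Only the left summand decides between ∞₁ and ∞₂, so 0 + ∞₁ = ∞₂.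
  _+₂_ : ℕ∞₂ → ℕ∞₂ → ℕ∞₂
  nat a +₂ nat b = nat (a + b)
  nat a +₂ _     = ∞₂
  ∞₁    +₂ _     = ∞₁
  ∞₂    +₂ _     = ∞₂

  _*₂_ : ℕ∞₂ → ℕ∞₂ → ℕ∞₂
  nat a    *₂ nat b    = nat (a * b)
  nat zero *₂ _        = nat zero
  _        *₂ nat zero = nat zero
  _        *₂ _        = ∞₂

  ℕ∞₂-structure : Structure
  ℕ∞₂-structure = ≡-structure ℕ∞₂ (nat 0) suc₂ _+₂_ _*₂_

  open Interpretation ℕ∞₂-structure hiding (_+_; _*_)

  suc₂-injective : ∀ {x y} → suc₂ x ≡ suc₂ y → x ≡ y
  suc₂-injective {nat a} {nat .a} refl = refl
  suc₂-injective {∞₁} {∞₁} refl        = refl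
  suc₂-injective {∞₂} {∞₂} refl        = refl

  ∞₂-predecessor : ∀ x → ¬ x ≡ nat 0 → Σ ℕ∞₂ λ y → x ≡ suc₂ y
  ∞₂-predecessor (nat zero) x≢0  = contradiction refl x≢0
  ∞₂-predecessor (nat (suc a)) _ = nat a , refl
  ∞₂-predecessor ∞₁ _            = ∞₁ , refl
  ∞₂-predecessor ∞₂ _            = ∞₂ , refl

  +₂-identityʳ : ∀ x → x +₂ nat 0 ≡ x
  +₂-identityʳ (nat a) = cong nat (+-identityʳ a)
  +₂-identityʳ ∞₁      = refl
  +₂-identityʳ ∞₂      = refl

  +₂-suc : ∀ x y → x +₂ suc₂ y ≡ suc₂ (x +₂ y)
  +₂-suc (nat a) (nat b) = cong nat (+-suc a b)
  +₂-suc (nat a) ∞₁      = refl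
  +₂-suc (nat a) ∞₂      = refl
  +₂-suc ∞₁ y            = refl
  +₂-suc ∞₂ y            = refl

  *₂-zeroʳ : ∀ x → x *₂ nat 0 ≡ nat 0
  *₂-zeroʳ (nat a) = cong nat (*-zeroʳ a)
  *₂-zeroʳ ∞₁      = refl
  *₂-zeroʳ ∞₂      = refl

  *₂-suc : ∀ x y → x *₂ suc₂ y ≡ x *₂ y +₂ x
  *₂-suc (nat a) (nat b)       = cong nat (trans (*-suc a b) (+-comm a (a * b)))
  *₂-suc (nat zero) ∞₁         = refl
  *₂-suc (nat zero) ∞₂         = refl
  *₂-suc (nat (suc a)) ∞₁      = refl
  *₂-suc (nat (suc a)) ∞₂      = refl
  *₂-suc ∞₁ (nat zero)         = refl
  *₂-suc ∞₁ (nat (suc b))      = refl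
  *₂-suc ∞₁ ∞₁                 = refl
  *₂-suc ∞₁ ∞₂                 = refl
  *₂-suc ∞₂ (nat zero)         = refl
  *₂-suc ∞₂ (nat (suc b))      = refl
  *₂-suc ∞₂ ∞₁                 = refl
  *₂-suc ∞₂ ∞₂                 = refl

  ℕ∞₂-QLaws : QLaws
  ℕ∞₂-QLaws = record
    { suc-≉-0       = λ { (nat a) () ; ∞₁ () ; ∞₂ () }
    ; suc-injective = suc₂-injective
    ; predecessor   = ∞₂-predecessor
    ; +-identityʳ   = +₂-identityʳ
    ; +-suc         = +₂-suc
    ; *-zeroʳ       = *₂-zeroʳ
    ; *-suc         = *₂-suc
    }

  module ∞ = Interpretation ℕ∞-structure
  open Homomorphism ℕ∞₂-structure ℕ∞-structure

  collapse : ℕ∞₂ → ℕ∞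
  collapse (nat a) = fin a
  collapse ∞₁      = ∞
  collapse ∞₂      = ∞

  collapse-+ : ∀ x y → collapse (x +₂ y) ≡ collapse x +∞ collapse y
  collapse-+ (nat a) (nat b) = refl
  collapse-+ (nat a) ∞₁      = refl
  collapse-+ (nat a) ∞₂      = refl
  collapse-+ ∞₁ y            = refl
  collapse-+ ∞₂ y            = refl

  collapse-* : ∀ x y → collapse (x *₂ y) ≡ collapse x *∞ collapse y
  collapse-* (nat a) (nat b)       = refl
  collapse-* (nat zero) ∞₁         = refl
  collapse-* (nat zero) ∞₂         = refl
  collapse-* (nat (suc a)) ∞₁      = refl
  collapse-* (nat (suc a)) ∞₂      = refl
  collapse-* ∞₁ (nat zero)         = refl
  collapse-* ∞₁ (nat (suc b))      = refl
  collapse-* ∞₁ ∞₁                 = refl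
  collapse-* ∞₁ ∞₂                 = refl
  collapse-* ∞₂ (nat zero)         = refl
  collapse-* ∞₂ (nat (suc b))      = refl
  collapse-* ∞₂ ∞₁                 = refl
  collapse-* ∞₂ ∞₂                 = refl

  collapse-isHomomorphism : IsHomomorphism collapse
  collapse-isHomomorphism = record
    { 0-hom   = refl
    ; suc-hom = λ { (nat a) → refl ; ∞₁ → refl ; ∞₂ → refl }
    ; +-hom   = collapse-+
    ; *-hom   = collapse-*
    }

  collapse-≤ₘ : ∀ {u v} → (u ≤ₘ v) ⇔ (collapse u ∞.≤ₘ collapse v)
  collapse-≤ₘ {u} {v} = mk⇔ (λ (r , e) → collapse r , trans (sym (collapse-+ r u)) (cong collapse e)) (reflect u v)
    where
      reflect : ∀ u v → collapse u ∞.≤ₘ collapse v → u ≤ₘ v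
      reflect u ∞₁ _                     = ∞₁ , refl
      reflect u ∞₂ _                     = ∞₂ , refl
      reflect (nat a) (nat b) (fin c , refl) = nat c , refl
      reflect ∞₁ (nat b) (fin c , ())
      reflect ∞₂ (nat b) (fin c , ())

  ≼-collapse : ∀ {n} (t s : Term (suc n)) (ρ : Env n) d →
               ⟦ t ≼ s ⟧ (d ∷ᵥ ρ) ⇔ ∞.⟦ t ≼ s ⟧ (collapse d ∷ᵥ collapse ∘ ρ)
  ≼-collapse t s ρ d = ∞.⟦⟧-cong (t ≼ s) (λ { fz → refl ; (fs i) → refl })
                       ⇔-∘ ≼-transfer collapse-isHomomorphism collapse-≤ₘ t s (d ∷ᵥ ρ)

  numeral≡nat : ∀ m → numeral m ≡ nat m
  numeral≡nat zero    = refl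
  numeral≡nat (suc m) = cong suc₂ (numeral≡nat m)

  ≼-induction : ∀ {n} (t s : Term (suc n)) → InductionHolds (t ≼ s)
  ≼-induction t s ρ φ₀ φₛ = at
    where
      at-nat : ∀ m → ⟦ t ≼ s ⟧ (nat m ∷ᵥ ρ)
      at-nat m = subst (λ d → ⟦ t ≼ s ⟧ (d ∷ᵥ ρ)) (numeral≡nat m) (induction-numerals (t ≼ s) φ₀ φₛ m)
      at-∞ : ∀ d → collapse d ≡ ∞ → ⟦ t ≼ s ⟧ (d ∷ᵥ ρ)
      at-∞ d d↦∞ = from (≼-collapse t s ρ d) (subst (λ x → ∞.⟦ t ≼ s ⟧ (x ∷ᵥ collapse ∘ ρ)) (sym d↦∞)
        (≼-at-∞ t s _ λ m → to (≼-collapse t s ρ (nat m)) (at-nat m)))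
      at : ∀ d → ⟦ t ≼ s ⟧ (d ∷ᵥ ρ)
      at (nat m) = at-nat m
      at ∞₁      = at-∞ ∞₁ refl
      at ∞₂      = at-∞ ∞₂ refl

  ℕ∞₂-models-I≤ : Models (I le)
  ℕ∞₂-models-I≤ = models-I (models-Q ℕ∞₂-QLaws) ≼-induction

  ℕ∞₂-refutes-I= : ¬ ⟦ indAx {0} (atom eq (𝟘 ⊕ var fz) (var fz)) ⟧ []ᵥ
  ℕ∞₂-refutes-I= = ¬induction-0+x≈x ℕ∞₂-QLaws ∞₁ λ ()

module Polynomials where

  open Semantics
  open import Data.Nat as ℕ using (ℕ; zero; suc; _⊔_; z≤n; s≤s) renaming (_≤_ to _≤ℕ_)
  import Data.Nat.Properties as ℕ
  open import Data.Integer using (ℤ; +_; _+_; _*_; _-_; 0ℤ; 1ℤ; -1ℤ)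
  import Data.Integer.Properties as ℤ
  open import Data.Integer.Tactic.RingSolver using (solve-∀)
  open import Data.Fin using (Fin; toℕ) renaming (zero to fz; suc to fs)
  open import Data.List using (List; []; _∷_; length; map)
  open import Data.List.Properties using (length-map)
  open import Data.Sum using (inj₂)
  open import Data.Vec.Functional using (Vector) renaming (_∷_ to _∷ᵥ_)
  open import Relation.Binary.PropositionalEquality using (_≡_; refl; sym; trans; cong; cong₂; module ≡-Reasoning)

  Poly : Set
  Poly = List ℤ

  -- Coefficient lists, constant term first.
  eval : Poly → ℤ → ℤ
  eval [] y      = 0ℤ
  eval (c ∷ P) y = c + y * eval P y

  eval-constant : ∀ c y → eval (c ∷ []) y ≡ c
  eval-constant c y = trans (cong (_+_ c) (ℤ.*-zeroʳ y)) (ℤ.+-identityʳ c)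

  xₚ : Poly
  xₚ = 0ℤ ∷ 1ℤ ∷ []

  eval-xₚ : ∀ y → eval xₚ y ≡ y
  eval-xₚ y = trans (ℤ.+-identityˡ _) (trans (cong (_*_ y) (eval-constant 1ℤ y)) (ℤ.*-identityʳ y))

  infixl 6 _+ₚ_
  infixl 7 _·ₚ_ _*ₚ_

  _+ₚ_ : Poly → Poly → Poly
  [] +ₚ Q            = Q
  (p ∷ P) +ₚ []      = p ∷ P
  (p ∷ P) +ₚ (q ∷ Q) = (p + q) ∷ (P +ₚ Q)

  _·ₚ_ : ℤ → Poly → Poly
  c ·ₚ P = map (c *_) P

  _*ₚ_ : Poly → Poly → Poly
  [] *ₚ Q      = []
  (p ∷ P) *ₚ Q = p ·ₚ Q +ₚ (0ℤ ∷ P *ₚ Q)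

  shift : ℤ → Poly → Poly
  shift c []      = []
  shift c (d ∷ P) = (d ∷ []) +ₚ (c ·ₚ shift c P +ₚ (0ℤ ∷ shift c P))

  eval-+ₚ : ∀ P Q y → eval (P +ₚ Q) y ≡ eval P y + eval Q y
  eval-+ₚ [] Q y            = sym (ℤ.+-identityˡ _)
  eval-+ₚ (p ∷ P) [] y      = sym (ℤ.+-identityʳ _)
  eval-+ₚ (p ∷ P) (q ∷ Q) y rewrite eval-+ₚ P Q y = regroup p q y (eval P y) (eval Q y)
    where
      regroup : ∀ p q y a b → (p + q) + y * (a + b) ≡ (p + y * a) + (q + y * b)
      regroup = solve-∀

  eval-·ₚ : ∀ c P y → eval (c ·ₚ P) y ≡ c * eval P y
  eval-·ₚ c [] y      = sym (ℤ.*-zeroʳ c)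
  eval-·ₚ c (p ∷ P) y rewrite eval-·ₚ c P y = factor c p y (eval P y)
    where
      factor : ∀ c p y a → c * p + y * (c * a) ≡ c * (p + y * a)
      factor = solve-∀

  eval-*ₚ : ∀ P Q y → eval (P *ₚ Q) y ≡ eval P y * eval Q y
  eval-*ₚ [] Q y = refl
  eval-*ₚ (p ∷ P) Q y
    rewrite eval-+ₚ (p ·ₚ Q) (0ℤ ∷ P *ₚ Q) y | eval-·ₚ p Q y | eval-*ₚ P Q y = factor p y (eval P y) (eval Q y)
    where
      factor : ∀ p y a b → p * b + (0ℤ + y * (a * b)) ≡ (p + y * a) * b
      factor = solve-∀

  eval-shift : ∀ c P y → eval (shift c P) y ≡ eval P (y + c)
  eval-shift c [] y = refl
  eval-shift c (d ∷ P) y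
    rewrite eval-+ₚ (d ∷ []) (c ·ₚ shift c P +ₚ (0ℤ ∷ shift c P)) y
          | eval-+ₚ (c ·ₚ shift c P) (0ℤ ∷ shift c P) y
          | eval-·ₚ c (shift c P) y
          | eval-shift c P y = factor d y c (eval P (y + c))
    where
      factor : ∀ d y c q → (d + y * 0ℤ) + (c * q + (0ℤ + y * q)) ≡ d + (y + c) * q
      factor = solve-∀

  length-+ₚ : ∀ P Q → length (P +ₚ Q) ≤ℕ length P ⊔ length Q
  length-+ₚ [] Q            = ℕ.≤-refl
  length-+ₚ (p ∷ P) []      = ℕ.≤-refl
  length-+ₚ (p ∷ P) (q ∷ Q) = s≤s (length-+ₚ P Q)

  length-·ₚ : ∀ c P → length (c ·ₚ P) ≡ length P
  length-·ₚ c = length-map (c *_)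

  length-*ₚ : ∀ P Q → length (P *ₚ Q) ≤ℕ length P ℕ.+ length Q
  length-*ₚ [] Q      = z≤n
  length-*ₚ (p ∷ P) Q = ℕ.≤-trans (length-+ₚ (p ·ₚ Q) (0ℤ ∷ P *ₚ Q))
    (ℕ.⊔-lub (ℕ.≤-trans (ℕ.≤-reflexive (length-·ₚ p Q)) (ℕ.m≤n+m _ (suc (length P))))
             (s≤s (length-*ₚ P Q)))

  length-shift : ∀ c P → length (shift c P) ≤ℕ length P
  length-shift c []      = z≤n
  length-shift c (d ∷ P) = ℕ.≤-trans (length-+ₚ (d ∷ []) (c ·ₚ Q +ₚ (0ℤ ∷ Q))) (ℕ.⊔-lub (s≤s z≤n)
    (ℕ.≤-trans (length-+ₚ (c ·ₚ Q) (0ℤ ∷ Q)) (ℕ.⊔-lub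
      (ℕ.≤-trans (ℕ.≤-reflexive (length-·ₚ c Q)) (ℕ.m≤n⇒m≤1+n (length-shift c P)))
      (s≤s (length-shift c P)))))
    where
      Q : Poly
      Q = shift c P

  vanishing     : ∀ L P b → length P ≤ℕ L → (∀ (k : Fin L) → eval P (b + + toℕ k) ≡ 0ℤ) → ∀ y → eval P y ≡ 0ℤ
  vanishing-at-0 : ∀ L P → length P ≤ℕ L → (∀ (k : Fin L) → eval P (+ toℕ k) ≡ 0ℤ) → ∀ y → eval P y ≡ 0ℤ

  vanishing L P b len zeros y = begin
    eval P y                 ≡⟨ cong (eval P) (y≡y-b+b y b) ⟩
    eval P (y - b + b)       ≡⟨ eval-shift b P (y - b) ⟨
    eval (shift b P) (y - b) ≡⟨ vanishing-at-0 L (shift b P) (ℕ.≤-trans (length-shift b P) len) shifted-zeros (y - b) ⟩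
    0ℤ                       ∎
    where
      open ≡-Reasoning
      y≡y-b+b : ∀ y b → y ≡ y - b + b
      y≡y-b+b = solve-∀
      shifted-zeros : ∀ k → eval (shift b P) (+ toℕ k) ≡ 0ℤ
      shifted-zeros k = trans (eval-shift b P _) (trans (cong (eval P) (ℤ.+-comm (+ toℕ k) b)) (zeros k))

  vanishing-at-0 L [] _ _ y                      = refl
  vanishing-at-0 (suc L) (d ∷ P) len zeros y = begin
    d + y * eval P y  ≡⟨ cong₂ (λ a b → a + y * b) d≡0 (vanishing L P 1ℤ (ℕ.≤-pred len) P-zeros y) ⟩
    0ℤ + y * 0ℤ       ≡⟨ trans (ℤ.+-identityˡ _) (ℤ.*-zeroʳ y) ⟩
    0ℤ                ∎
    where
      open ≡-Reasoning
      d≡0 : d ≡ 0ℤ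
      d≡0 = trans (sym (ℤ.+-identityʳ d)) (zeros fz)
      P-zeros : ∀ (k : Fin L) → eval P (+ suc (toℕ k)) ≡ 0ℤ
      P-zeros k with ℤ.i*j≡0⇒i≡0∨j≡0 (+ suc (toℕ k))
                       (trans (sym (ℤ.+-identityˡ _)) (trans (cong (_+ _) (sym d≡0)) (zeros (fs k))))
      ... | inj₂ P≡0 = P≡0

  ℤ-structure : Structure
  ℤ-structure = ≡-structure ℤ 0ℤ (_+ 1ℤ) _+_ _*_

  module ℤ-terms = Interpretation ℤ-structure

  toPoly : ∀ {m} → Term (suc m) → Vector ℤ m → Poly
  toPoly (var fz) π     = xₚ
  toPoly (var (fs i)) π = π i ∷ []
  toPoly 𝟘 π            = []
  toPoly (S t) π        = toPoly t π +ₚ (1ℤ ∷ [])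
  toPoly (t ⊕ s) π      = toPoly t π +ₚ toPoly s π
  toPoly (t ⊙ s) π      = toPoly t π *ₚ toPoly s π

  lengthBound : ∀ {m} → Term (suc m) → ℕ
  lengthBound (var fz)     = 2
  lengthBound (var (fs i)) = 1
  lengthBound 𝟘            = 0
  lengthBound (S t)        = lengthBound t ⊔ 1
  lengthBound (t ⊕ s)      = lengthBound t ⊔ lengthBound s
  lengthBound (t ⊙ s)      = lengthBound t ℕ.+ lengthBound s

  eval-toPoly : ∀ {m} (t : Term (suc m)) π y → ℤ-terms.⟦ t ⟧ₜ (y ∷ᵥ π) ≡ eval (toPoly t π) y
  eval-toPoly (var fz) π y     = sym (eval-xₚ y)
  eval-toPoly (var (fs i)) π y = sym (eval-constant (π i) y)
  eval-toPoly 𝟘 π y            = refl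
  eval-toPoly (S t) π y = trans (cong₂ _+_ (eval-toPoly t π y) (sym (eval-constant 1ℤ y))) (sym (eval-+ₚ (toPoly t π) _ y))
  eval-toPoly (t ⊕ s) π y = trans (cong₂ _+_ (eval-toPoly t π y) (eval-toPoly s π y)) (sym (eval-+ₚ (toPoly t π) _ y))
  eval-toPoly (t ⊙ s) π y = trans (cong₂ _*_ (eval-toPoly t π y) (eval-toPoly s π y)) (sym (eval-*ₚ (toPoly t π) _ y))

  length-toPoly : ∀ {m} (t : Term (suc m)) π → length (toPoly t π) ≤ℕ lengthBound t
  length-toPoly (var fz) π     = ℕ.≤-refl
  length-toPoly (var (fs i)) π = ℕ.≤-refl
  length-toPoly 𝟘 π            = z≤n
  length-toPoly (S t) π        = ℕ.≤-trans (length-+ₚ (toPoly t π) _) (ℕ.⊔-monoˡ-≤ 1 (length-toPoly t π))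
  length-toPoly (t ⊕ s) π      = ℕ.≤-trans (length-+ₚ (toPoly t π) _) (ℕ.⊔-mono-≤ (length-toPoly t π) (length-toPoly s π))
  length-toPoly (t ⊙ s) π      = ℕ.≤-trans (length-*ₚ (toPoly t π) _) (ℕ.+-mono-≤ (length-toPoly t π) (length-toPoly s π))

  terms-agree : ∀ {m} (t s : Term (suc m)) π b →
    (∀ (k : Fin (lengthBound t ⊔ lengthBound s)) →
       ℤ-terms.⟦ t ⟧ₜ (b + + toℕ k ∷ᵥ π) ≡ ℤ-terms.⟦ s ⟧ₜ (b + + toℕ k ∷ᵥ π)) →
    ∀ y → ℤ-terms.⟦ t ⟧ₜ (y ∷ᵥ π) ≡ ℤ-terms.⟦ s ⟧ₜ (y ∷ᵥ π)
  terms-agree t s π b agree y = ℤ.i-j≡0⇒i≡j _ _ (trans (eval-difference y) (vanishing _ D b length-D D-zeros y))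
    where
      D : Poly
      D = toPoly t π +ₚ -1ℤ ·ₚ toPoly s π
      eval-difference : ∀ y → ℤ-terms.⟦ t ⟧ₜ (y ∷ᵥ π) - ℤ-terms.⟦ s ⟧ₜ (y ∷ᵥ π) ≡ eval D y
      eval-difference y
        rewrite eval-+ₚ (toPoly t π) (-1ℤ ·ₚ toPoly s π) y | eval-·ₚ -1ℤ (toPoly s π) y
              | eval-toPoly t π y | eval-toPoly s π y = minus (eval (toPoly t π) y) (eval (toPoly s π) y)
        where
          minus : ∀ a b → a - b ≡ a + -1ℤ * b
          minus = solve-∀
      length-D : length D ≤ℕ lengthBound t ⊔ lengthBound s
      length-D = ℕ.≤-trans (length-+ₚ (toPoly t π) _)
        (ℕ.⊔-mono-≤ (length-toPoly t π) (ℕ.≤-trans (ℕ.≤-reflexive (length-·ₚ -1ℤ (toPoly s π))) (length-toPoly s π)))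
      D-zeros : ∀ k → eval D (b + + toℕ k) ≡ 0ℤ
      D-zeros k = trans (sym (eval-difference _)) (ℤ.i≡j⇒i-j≡0 (agree k))

module ℤ[X]⁺-Model where

  open Semantics
  open Polynomials
  open import Data.Nat as ℕ using (ℕ; zero; suc; _⊔_; z≤n; s≤s) renaming (_≤_ to _≤ℕ_)
  import Data.Nat.Properties as ℕ
  open import Data.Integer using (ℤ; +_; -[1+_]; _+_; _*_; -_; _-_; 0ℤ; 1ℤ; -1ℤ; _≤_; +≤+; -≤-; -<+; ∣_∣)
  import Data.Integer.Properties as ℤ
  open import Data.Integer.Tactic.RingSolver using (solve-∀)
  open import Data.Fin using (Fin; toℕ) renaming (zero to fz; suc to fs)
  open import Data.Fin.Properties using (toℕ<n)
  open import Data.List using ([]; _∷_)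
  open import Data.Product using (Σ-syntax; _×_; _,_)
  open import Data.Sum using (_⊎_; inj₁; inj₂)
  open import Data.Vec.Functional using (Vector) renaming (_∷_ to _∷ᵥ_; [] to []ᵥ)
  open import Function using (_∘_; Equivalence)
  open import Relation.Binary.PropositionalEquality using (_≡_; _≢_; refl; sym; trans; cong; cong₂; subst; module ≡-Reasoning)
  open import Relation.Nullary using (¬_)
  open import Relation.Nullary.Negation using (¬¬-map; contradiction)

  Eventually : (ℕ → Set) → Set
  Eventually A = Σ[ N ∈ ℕ ] (∀ n → N ≤ℕ n → A n)

  always : ∀ {A : ℕ → Set} → (∀ n → A n) → Eventually A
  always a = 0 , λ n _ → a n

  eventually-≥ : ∀ N → Eventually (N ≤ℕ_)
  eventually-≥ N = N , λ _ N≤n → N≤n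

  eventually-map : ∀ {A B : ℕ → Set} → (∀ {n} → A n → B n) → Eventually A → Eventually B
  eventually-map f (N , a) = N , λ n N≤n → f (a n N≤n)

  eventually-× : ∀ {A B : ℕ → Set} → Eventually A → Eventually B → Eventually (λ n → A n × B n)
  eventually-× (N , a) (M , b) = N ⊔ M , λ n N⊔M≤n →
    a n (ℕ.≤-trans (ℕ.m≤m⊔n N M) N⊔M≤n) , b n (ℕ.≤-trans (ℕ.m≤n⊔m N M) N⊔M≤n)

  eventually-∀ : ∀ {L} {A : Fin L → ℕ → Set} → (∀ k → Eventually (A k)) → Eventually (λ n → ∀ k → A k n)
  eventually-∀ {zero} ev  = always λ _ ()
  eventually-∀ {suc L} ev = eventually-map (λ (a₀ , a) → λ { fz → a₀ ; (fs k) → a k })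
                                           (eventually-× (ev fz) (eventually-∀ (ev ∘ fs)))

  eventually-witness : ∀ {A : ℕ → Set} → Eventually A → Σ[ n ∈ ℕ ] (1 ≤ℕ n × A n)
  eventually-witness (N , a) = suc N , s≤s z≤n , a (suc N) (ℕ.n≤1+n N)

  ¬¬-∀ : ∀ {L} {A : Fin L → Set} → (∀ k → ¬ ¬ A k) → ¬ ¬ (∀ k → A k)
  ¬¬-∀ {zero} h  = contradiction λ ()
  ¬¬-∀ {suc L} h = λ ¬all → h fz λ a₀ → ¬¬-∀ (h ∘ fs) λ a → ¬all λ { fz → a₀ ; (fs k) → a k }

  value : Poly → ℕ → ℤ
  value P n = eval P (+ n)

  record ℤ[X]⁺ : Set where
    constructor poly
    field
      coefficients : Poly
      nonNegative  : Eventually λ n → 0ℤ ≤ value coefficients n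
  open ℤ[X]⁺

  at : ℤ[X]⁺ → ℕ → ℤ
  at a = value (coefficients a)

  infixl 6 _+ᵖ_
  infixl 7 _*ᵖ_

  _+ᵖ_ : ℤ[X]⁺ → ℤ[X]⁺ → ℤ[X]⁺
  poly P P≥0 +ᵖ poly Q Q≥0 = poly (P +ₚ Q) (eventually-map
    (λ {n} (p , q) → subst (0ℤ ≤_) (sym (eval-+ₚ P Q (+ n))) (ℤ.+-mono-≤ p q)) (eventually-× P≥0 Q≥0))

  _*ᵖ_ : ℤ[X]⁺ → ℤ[X]⁺ → ℤ[X]⁺
  poly P P≥0 *ᵖ poly Q Q≥0 = poly (P *ₚ Q) (eventually-map
    (λ {n} (p , q) → subst (0ℤ ≤_) (sym (eval-*ₚ P Q (+ n))) (nonNeg-* p q)) (eventually-× P≥0 Q≥0))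
    where
      nonNeg-* : ∀ {a b} → 0ℤ ≤ a → 0ℤ ≤ b → 0ℤ ≤ a * b
      nonNeg-* {+ a} {+ b} _ _ = subst (0ℤ ≤_) (ℤ.pos-* a b) (+≤+ z≤n)

  minus : (a : ℤ[X]⁺) (j : ℕ) → Eventually (λ n → + j ≤ at a n) → ℤ[X]⁺
  minus (poly P _) j P≥j = poly (P +ₚ (- + j ∷ [])) (eventually-map
    (λ {n} p → subst (0ℤ ≤_) (sym (trans (eval-+ₚ P _ (+ n)) (cong (_+_ (eval P (+ n))) (eval-constant (- + j) (+ n)))))
                     (ℤ.i≤j⇒0≤j-i p)) P≥j)

  zeroᵖ : ℤ[X]⁺
  zeroᵖ = poly [] (always λ _ → +≤+ z≤n)

  oneᵖ : ℤ[X]⁺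
  oneᵖ = poly (1ℤ ∷ []) (always λ n → subst (0ℤ ≤_) (sym (eval-constant 1ℤ (+ n))) (+≤+ z≤n))

  sucᵖ : ℤ[X]⁺ → ℤ[X]⁺
  sucᵖ a = a +ᵖ oneᵖ

  at-+ : ∀ a b n → at (a +ᵖ b) n ≡ at a n + at b n
  at-+ (poly P _) (poly Q _) n = eval-+ₚ P Q (+ n)

  at-* : ∀ a b n → at (a *ᵖ b) n ≡ at a n * at b n
  at-* (poly P _) (poly Q _) n = eval-*ₚ P Q (+ n)

  at-suc : ∀ a n → at (sucᵖ a) n ≡ at a n + 1ℤ
  at-suc a n = trans (at-+ a oneᵖ n) (cong (_+_ (at a n)) (eval-constant 1ℤ (+ n)))

  at-minus : ∀ a j a≥j n → at (minus a j a≥j) n ≡ at a n - + j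
  at-minus (poly P _) j _ n = trans (eval-+ₚ P _ (+ n)) (cong (_+_ (value P n)) (eval-constant (- + j) (+ n)))

  infix 4 _≈ᵖ_
  _≈ᵖ_ : ℤ[X]⁺ → ℤ[X]⁺ → Set
  a ≈ᵖ b = Eventually λ n → at a n ≡ at b n

  ℤ[X]⁺-structure : Structure
  ℤ[X]⁺-structure = record
    { Carrier       = ℤ[X]⁺
    ; _≈_           = _≈ᵖ_
    ; isEquivalence = record
      { refl  = always λ _ → refl
      ; sym   = eventually-map sym
      ; trans = λ p q → eventually-map (λ (e , f) → trans e f) (eventually-× p q)
      }
    ; 0#            = zeroᵖ
    ; suc#          = sucᵖ
    ; _+_           = _+ᵖ_
    ; _*_           = _*ᵖ_
    ; suc-cong      = λ {a} {b} → eventually-map λ {n} e → trans (at-suc a n) (trans (cong (_+ 1ℤ) e) (sym (at-suc b n)))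
    ; +-cong        = λ {a} {b} {c} {d} p q → eventually-map (λ {n} (e , f) →
                        trans (at-+ a c n) (trans (cong₂ _+_ e f) (sym (at-+ b d n)))) (eventually-× p q)
    ; *-cong        = λ {a} {b} {c} {d} p q → eventually-map (λ {n} (e , f) →
                        trans (at-* a c n) (trans (cong₂ _*_ e f) (sym (at-* b d n)))) (eventually-× p q)
    }

  open Interpretation ℤ[X]⁺-structure hiding (_+_; _*_)
  open Equivalence using (to)
  open Homomorphism ℤ[X]⁺-structure ℤ-structure

  at-isHomomorphism : ∀ n → IsHomomorphism (λ a → at a n)
  at-isHomomorphism n = record
    { 0-hom   = refl
    ; suc-hom = λ a → at-suc a n
    ; +-hom   = λ a b → at-+ a b n
    ; *-hom   = λ a b → at-* a b n
    }

  at-⟦⟧ : ∀ {m} (t : Term (suc m)) (ρ : Env m) d n →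
          at (⟦ t ⟧ₜ (d ∷ᵥ ρ)) n ≡ ℤ-terms.⟦ t ⟧ₜ (at d n ∷ᵥ λ i → at (ρ i) n)
  at-⟦⟧ t ρ d n = trans (⟦⟧ₜ-hom (at-isHomomorphism n) t (d ∷ᵥ ρ))
                        (ℤ-terms.⟦⟧ₜ-cong t λ { fz → refl ; (fs i) → refl })

  at-numeral : ∀ j n → at (numeral j) n ≡ + j
  at-numeral zero n    = refl
  at-numeral (suc j) n = trans (at-suc (numeral j) n) (trans (cong (_+ 1ℤ) (at-numeral j n)) (cong +_ (ℕ.+-comm j 1)))

  data EventualSign (f : ℕ → ℤ) : Set where
    vanishes : Eventually (λ n → f n ≡ 0ℤ)  → EventualSign f
    positive  : Eventually (λ n → 1ℤ ≤ f n)  → EventualSign f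
    negative  : Eventually (λ n → f n ≤ -1ℤ) → EventualSign f

  eventually-constant-sign : ∀ {f} c → Eventually (λ n → f n ≡ c) → EventualSign f
  eventually-constant-sign (+ zero) f≡c     = vanishes f≡c
  eventually-constant-sign (+ suc m) f≡c   = positive (eventually-map (λ e → subst (1ℤ ≤_) (sym e) (+≤+ (s≤s z≤n))) f≡c)
  eventually-constant-sign -[1+ m ] f≡c    = negative (eventually-map (λ e → subst (_≤ -1ℤ) (sym e) (-≤- z≤n)) f≡c)

  linear-dominates : ∀ c q n → 1ℤ ≤ q → suc ∣ c ∣ ≤ℕ n → 1ℤ ≤ c + + n * q
  linear-dominates c q n q≥1 n>∣c∣ = ℤ.≤-trans (c+n≥1 c n>∣c∣)
    (ℤ.+-monoʳ-≤ c (subst (_≤ + n * q) (ℤ.*-identityʳ (+ n)) (ℤ.*-monoˡ-≤-nonNeg (+ n) q≥1)))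
    where
      c+n≥1 : ∀ c {n} → suc ∣ c ∣ ≤ℕ n → 1ℤ ≤ c + + n
      c+n≥1 (+ m) {n} n>m    = +≤+ (ℕ.≤-trans (s≤s z≤n) (ℕ.≤-trans n>m (ℕ.m≤n+m n m)))
      c+n≥1 -[1+ m ] n>m     = subst (1ℤ ≤_) (sym (ℤ.⊖-≥ (ℕ.<⇒≤ n>m))) (+≤+ (ℕ.m<n⇒0<n∸m n>m))

  linear-dominates⁻ : ∀ c q n → q ≤ -1ℤ → suc ∣ c ∣ ≤ℕ n → c + + n * q ≤ -1ℤ
  linear-dominates⁻ c q n q≤-1 n>∣c∣ = subst (_≤ -1ℤ) (ℤ.neg-involutive _) (ℤ.neg-mono-≤ (subst (1ℤ ≤_) (negate c q (+ n))
    (linear-dominates (- c) (- q) n (ℤ.neg-mono-≤ q≤-1) (subst (λ k → suc k ≤ℕ n) (sym (ℤ.∣-i∣≡∣i∣ c)) n>∣c∣))))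
    where
      negate : ∀ c q n → - c + n * - q ≡ - (c + n * q)
      negate = solve-∀

  eventualSign : ∀ P → EventualSign (value P)
  eventualSign []      = vanishes (always λ _ → refl)
  eventualSign (c ∷ Q) with eventualSign Q
  ... | vanishes Q≡0  = eventually-constant-sign c (eventually-map (λ {n} e →
          trans (cong (λ q → c + + n * q) e) (trans (cong (_+_ c) (ℤ.*-zeroʳ (+ n))) (ℤ.+-identityʳ c))) Q≡0)
  ... | positive Q≥1  = positive (eventually-map (λ {n} (q≥1 , n>∣c∣) → linear-dominates c _ n q≥1 n>∣c∣)
                                                 (eventually-× Q≥1 (eventually-≥ (suc ∣ c ∣))))
  ... | negative Q≤-1 = negative (eventually-map (λ {n} (q≤-1 , n>∣c∣) → linear-dominates⁻ c _ n q≤-1 n>∣c∣)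
                                                 (eventually-× Q≤-1 (eventually-≥ (suc ∣ c ∣))))

  minus-plus : ∀ a b → a - b + b ≡ a
  minus-plus = solve-∀

  numeral-or-large : ∀ a k → (Σ[ j ∈ ℕ ] a ≈ᵖ numeral j) ⊎ Eventually (λ n → + k ≤ at a n)
  numeral-or-large a zero = inj₂ (nonNegative a)
  numeral-or-large a (suc k) with numeral-or-large a k
  ... | inj₁ a≈j = inj₁ a≈j
  ... | inj₂ a≥k with eventualSign (coefficients (minus a k a≥k))
  ...   | vanishes a-k≡0 = inj₁ (k , eventually-map (λ {n} e →
            trans (ℤ.i-j≡0⇒i≡j _ _ (trans (sym (at-minus a k a≥k n)) e)) (sym (at-numeral k n))) a-k≡0)
  ...   | positive a-k≥1 = inj₂ (eventually-map (λ {n} e → subst (+ suc k ≤_) (minus-plus (at a n) (+ k))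
            (ℤ.+-monoˡ-≤ (+ k) (subst (1ℤ ≤_) (at-minus a k a≥k n) e))) a-k≥1)
  ...   | negative a-k≤-1 with eventually-witness (eventually-× a≥k a-k≤-1)
  ...     | n , _ , aₙ≥k , aₙ-k≤-1 = contradiction (ℤ.i≤j⇒0≤j-i aₙ≥k)
            (ℤ.<⇒≱ (ℤ.≤-<-trans (subst (_≤ -1ℤ) (at-minus a k a≥k n) aₙ-k≤-1) -<+))

  at-+ᵖ-suc : ∀ a b n → at (a +ᵖ sucᵖ b) n ≡ at (sucᵖ (a +ᵖ b)) n
  at-+ᵖ-suc a b n rewrite at-+ a (sucᵖ b) n | at-suc b n | at-suc (a +ᵖ b) n | at-+ a b n =
    sym (ℤ.+-assoc (at a n) (at b n) 1ℤ)

  at-*ᵖ-suc : ∀ a b n → at (a *ᵖ sucᵖ b) n ≡ at (a *ᵖ b +ᵖ a) n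
  at-*ᵖ-suc a b n rewrite at-* a (sucᵖ b) n | at-suc b n | at-+ (a *ᵖ b) a n | at-* a b n =
    distrib (at a n) (at b n)
    where
      distrib : ∀ a b → a * (b + 1ℤ) ≡ a * b + a
      distrib = solve-∀

  +1-injective : ∀ {x y} → x + 1ℤ ≡ y + 1ℤ → x ≡ y
  +1-injective {x} {y} e = trans (sym (plus-minus x)) (trans (cong (_- 1ℤ) e) (plus-minus y))
    where
      plus-minus : ∀ x → x + 1ℤ - 1ℤ ≡ x
      plus-minus = solve-∀

  sucᵖ-injective : ∀ {a b} → sucᵖ a ≈ᵖ sucᵖ b → a ≈ᵖ b
  sucᵖ-injective {a} {b} = eventually-map λ {n} e → +1-injective (trans (sym (at-suc a n)) (trans e (at-suc b n)))

  sucᵖ≉zeroᵖ : ∀ a → ¬ sucᵖ a ≈ᵖ zeroᵖ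
  sucᵖ≉zeroᵖ a e with eventually-witness (eventually-× e (nonNegative a))
  ... | n , _ , aₙ+1≡0 , aₙ≥0 = nonNegative+1≢0 aₙ≥0 (trans (sym (at-suc a n)) aₙ+1≡0)
    where
      nonNegative+1≢0 : ∀ {x} → 0ℤ ≤ x → x + 1ℤ ≢ 0ℤ
      nonNegative+1≢0 {+ m} _ e = ℕ.m+1+n≢0 m (ℤ.+-injective e)

  predecessorᵖ : ∀ a → ¬ a ≈ᵖ zeroᵖ → Σ[ b ∈ ℤ[X]⁺ ] a ≈ᵖ sucᵖ b
  predecessorᵖ a a≉0 with numeral-or-large a 1
  ... | inj₁ (zero , a≈0)    = contradiction a≈0 a≉0
  ... | inj₁ (suc j , a≈j+1) = numeral j , a≈j+1
  ... | inj₂ a≥1             = minus a 1 a≥1 , always λ n →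
    sym (trans (at-suc (minus a 1 a≥1) n) (trans (cong (_+ 1ℤ) (at-minus a 1 a≥1 n)) (minus-plus (at a n) 1ℤ)))

  +ᵖ-identityʳ : ∀ a → a +ᵖ zeroᵖ ≈ᵖ a
  +ᵖ-identityʳ a = always λ n → trans (at-+ a zeroᵖ n) (ℤ.+-identityʳ (at a n))

  +ᵖ-suc : ∀ a b → a +ᵖ sucᵖ b ≈ᵖ sucᵖ (a +ᵖ b)
  +ᵖ-suc a b = always (at-+ᵖ-suc a b)

  *ᵖ-zeroʳ : ∀ a → a *ᵖ zeroᵖ ≈ᵖ zeroᵖ
  *ᵖ-zeroʳ a = always λ n → trans (at-* a zeroᵖ n) (ℤ.*-zeroʳ (at a n))

  *ᵖ-suc : ∀ a b → a *ᵖ sucᵖ b ≈ᵖ a *ᵖ b +ᵖ a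
  *ᵖ-suc a b = always (at-*ᵖ-suc a b)

  ℤ[X]⁺-QLaws : QLaws
  ℤ[X]⁺-QLaws = record
    { suc-≉-0       = sucᵖ≉zeroᵖ
    ; suc-injective = λ {a} {b} → sucᵖ-injective {a} {b}
    ; predecessor   = predecessorᵖ
    ; +-identityʳ   = +ᵖ-identityʳ
    ; +-suc         = +ᵖ-suc
    ; *-zeroʳ       = *ᵖ-zeroʳ
    ; *-suc         = *ᵖ-suc
    }

  -- The values of e are eventually L consecutive integers, which pin down the polynomial t - s.
  agreement : ∀ {m} (t s : Term (suc m)) (ρ : Env m) (b : ℕ → ℤ)
    (e : Fin (lengthBound t ⊔ lengthBound s) → ℤ[X]⁺) →
    (∀ k → Eventually λ n → at (e k) n ≡ b n + + toℕ k) →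
    (∀ k → ⟦ t ⟧ₜ (e k ∷ᵥ ρ) ≈ᵖ ⟦ s ⟧ₜ (e k ∷ᵥ ρ)) →
    ∀ a → ⟦ t ⟧ₜ (a ∷ᵥ ρ) ≈ᵖ ⟦ s ⟧ₜ (a ∷ᵥ ρ)
  agreement t s ρ b e e-values e-agree a =
    eventually-map agree-at (eventually-∀ λ k → eventually-× (e-values k) (e-agree k))
    where
      π : ℕ → Vector ℤ _
      π n i = at (ρ i) n
      agree-at : ∀ {n} →
        (∀ k → (at (e k) n ≡ b n + + toℕ k) × (at (⟦ t ⟧ₜ (e k ∷ᵥ ρ)) n ≡ at (⟦ s ⟧ₜ (e k ∷ᵥ ρ)) n)) →
        at (⟦ t ⟧ₜ (a ∷ᵥ ρ)) n ≡ at (⟦ s ⟧ₜ (a ∷ᵥ ρ)) n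
      agree-at {n} h =
        trans (at-⟦⟧ t ρ a n) (trans (terms-agree t s (π n) (b n) agree-k (at a n)) (sym (at-⟦⟧ s ρ a n)))
        where
          agree-k : ∀ k → ℤ-terms.⟦ t ⟧ₜ (b n + + toℕ k ∷ᵥ π n) ≡ ℤ-terms.⟦ s ⟧ₜ (b n + + toℕ k ∷ᵥ π n)
          agree-k k with h k
          ... | eₖ≡ , tₖ≡sₖ rewrite sym eₖ≡ =
            trans (sym (at-⟦⟧ t ρ (e k) n)) (trans tₖ≡sₖ (at-⟦⟧ s ρ (e k) n))

  ℤ[X]⁺-models-Q : Models QAx
  ℤ[X]⁺-models-Q = models-Q ℤ[X]⁺-QLaws

  ≐-induction : ∀ {m} (t s : Term (suc m)) → InductionHolds (t ≐ s)
  ≐-induction t s ρ φ₀ φₛ a = ¬¬-map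
    (λ agree → agreement t s ρ (λ _ → 0ℤ) (numeral ∘ toℕ) (λ k → always (at-numeral (toℕ k))) agree a)
    (¬¬-∀ λ k → induction-numerals (t ≐ s) φ₀ φₛ (toℕ k))

  module _ {m} (t s : Term (suc m)) (ρ : Env m) where

    private
      P : ℤ[X]⁺ → Set
      P d = ⟦ t ≐ s ⟧ (d ∷ᵥ ρ)

      P-resp : ∀ {d d'} → d ≈ᵖ d' → P d → P d'
      P-resp d≈d' = to (⟦⟧-cong (t ≐ s) (∷-≋ d≈d' (≋-refl {ρ = ρ})))

      L : ℕ
      L = lengthBound t ⊔ lengthBound s

    descend : (∀ d → P (sucᵖ d) → P d) → ∀ c {j k} → k ℕ.≤′ j → P (c +ᵖ numeral j) → P (c +ᵖ numeral k)
    descend down c ℕ.≤′-refl          = λ p → p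
    descend down c (ℕ.≤′-step {j} k≤j) = descend down c k≤j ∘ down _ ∘ P-resp (+ᵖ-suc c (numeral j))

    ≐-reaches-0 : (∀ d → P (sucᵖ d) → P d) → ∀ a → P a → P zeroᵖ
    ≐-reaches-0 down a Pa with numeral-or-large a L
    ... | inj₁ (j , a≈j) = P-resp (+ᵖ-identityʳ zeroᵖ) (descend down zeroᵖ {j} (ℕ.≤⇒≤′ z≤n) (P-resp a≈0+j Pa))
      where
        a≈0+j : a ≈ᵖ zeroᵖ +ᵖ numeral j
        a≈0+j = eventually-map (λ {n} e → trans e (sym (trans (at-+ zeroᵖ (numeral j) n) (ℤ.+-identityˡ _)))) a≈j
    ... | inj₂ a≥L = ¬¬-map (λ agree → agreement t s ρ (at c) e e-values agree zeroᵖ)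
      (¬¬-∀ λ k → descend down c {k = toℕ k} (ℕ.≤⇒≤′ (ℕ.<⇒≤ (toℕ<n k))) (P-resp a≈c+L Pa))
      where
        c : ℤ[X]⁺
        c = minus a L a≥L
        e : Fin L → ℤ[X]⁺
        e k = c +ᵖ numeral (toℕ k)
        e-values : ∀ k → Eventually λ n → at (e k) n ≡ at c n + + toℕ k
        e-values k = always λ n → trans (at-+ c (numeral (toℕ k)) n) (cong (_+_ (at c n)) (at-numeral (toℕ k) n))
        a≈c+L : a ≈ᵖ c +ᵖ numeral L
        a≈c+L = always λ n → sym (trans (at-+ c (numeral L) n)
          (trans (cong₂ _+_ (at-minus a L a≥L n) (at-numeral L n)) (minus-plus (at a n) (+ L))))

  ≉-induction : ∀ {m} (t s : Term (suc m)) → InductionHolds (atom neq t s)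
  ≉-induction t s ρ φ₀ φₛ a t≐s = φ₀ (≐-reaches-0 t s ρ down a t≐s)
    where
      down : ∀ d → ⟦ t ≐ s ⟧ (sucᵖ d ∷ᵥ ρ) → ⟦ t ≐ s ⟧ (d ∷ᵥ ρ)
      down d p = ⟦⟧-stable (t ≐ s) _ λ ¬p → φₛ d ¬p p

  ℤ[X]⁺-models-I= : Models (I eq)
  ℤ[X]⁺-models-I= = models-I ℤ[X]⁺-models-Q ≐-induction

  ℤ[X]⁺-models-I≠ : Models (I neq)
  ℤ[X]⁺-models-I≠ = models-I ℤ[X]⁺-models-Q ≉-induction

  X : ℤ[X]⁺
  X = poly xₚ (always λ n → subst (0ℤ ≤_) (sym (eval-xₚ (+ n))) (+≤+ z≤n))

  at-X : ∀ n → at X n ≡ + n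
  at-X n = eval-xₚ (+ n)

  twice≢1 : ∀ u → u + u ≢ 1ℤ
  twice≢1 (+ zero) ()
  twice≢1 (+ suc m) e = ℕ.m+1+n≢0 m (ℕ.suc-injective (ℤ.+-injective e))
  twice≢1 -[1+ m ] ()

  ¬eventually-even : ∀ c (f : ℕ → ℤ) → ¬ Eventually (λ n → + n ≡ c + (f n + f n))
  ¬eventually-even c f (N , even) = twice≢1 (f (suc N) - f N) (begin
    (f (suc N) - f N) + (f (suc N) - f N)           ≡⟨ difference c (f (suc N)) (f N) ⟨
    c + (f (suc N) + f (suc N)) - (c + (f N + f N)) ≡⟨ cong₂ _-_ (even (suc N) (ℕ.n≤1+n N)) (even N ℕ.≤-refl) ⟨
    1ℤ + + N - + N                                  ≡⟨ successor-minus (+ N) ⟩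
    1ℤ                                              ∎)
    where
      open ≡-Reasoning
      difference : ∀ c a b → c + (a + a) - (c + (b + b)) ≡ (a - b) + (a - b)
      difference = solve-∀
      successor-minus : ∀ x → 1ℤ + x - x ≡ 1ℤ
      successor-minus = solve-∀

  trade-two : ∀ r r≥2 u w u' w' → (∀ n → at u' n + at w n ≡ at u n + at w' n + + 2) →
              r +ᵖ u ≈ᵖ w → minus r 2 r≥2 +ᵖ u' ≈ᵖ w'
  trade-two r r≥2 u w u' w' balance = eventually-map λ {n} r+u≡w → begin
    at (minus r 2 r≥2 +ᵖ u') n              ≡⟨ trans (at-+ (minus r 2 r≥2) u' n) (cong (_+ at u' n) (at-minus r 2 r≥2 n)) ⟩
    at r n - + 2 + at u' n                  ≡⟨ rearrange (at r n) (at u n) (at u' n) (at w n) ⟩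
    (at r n + at u n) + (at u' n + at w n) - at u n - at w n - + 2
                                            ≡⟨ cong₂ (λ a b → a + b - at u n - at w n - + 2) (trans (sym (at-+ r u n)) r+u≡w) (balance n) ⟩
    at w n + (at u n + at w' n + + 2) - at u n - at w n - + 2
                                            ≡⟨ cancel (at w n) (at u n) (at w' n) ⟩
    at w' n                                 ∎
    where
      open ≡-Reasoning
      rearrange : ∀ r u u' w → r - + 2 + u' ≡ (r + u) + (u' + w) - u - w - + 2
      rearrange = solve-∀
      cancel : ∀ w u w' → w + (u + w' + + 2) - u - w - + 2 ≡ w'
      cancel = solve-∀

  at-double-suc : ∀ d n → at (sucᵖ d +ᵖ sucᵖ d) n ≡ at (d +ᵖ d) n + + 2
  at-double-suc d n rewrite at-+ (sucᵖ d) (sucᵖ d) n | at-suc d n | at-+ d d n = regroup (at d n)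
    where
      regroup : ∀ a → a + 1ℤ + (a + 1ℤ) ≡ a + a + + 2
      regroup = solve-∀

  nonNegative+suc≢0 : ∀ {x} m → 0ℤ ≤ x → x + + suc m ≢ 0ℤ
  nonNegative+suc≢0 {+ k} m _ e = ℕ.m+1+n≢0 k (ℤ.+-injective e)

  double-≤-step : ∀ d → d +ᵖ d ≤ₘ X → sucᵖ d +ᵖ sucᵖ d ≤ₘ X
  double-≤-step d (r , r+2d≈X) with numeral-or-large r 2
  ... | inj₁ (j , r≈j) = contradiction (eventually-map (λ {n} (e , rₙ≡j) → begin
          + n                        ≡⟨ trans e (at-X n) ⟨
          at (r +ᵖ (d +ᵖ d)) n       ≡⟨ at-+ r (d +ᵖ d) n ⟩
          at r n + at (d +ᵖ d) n     ≡⟨ cong₂ _+_ (trans rₙ≡j (at-numeral j n)) (at-+ d d n) ⟩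
          + j + (at d n + at d n)    ∎) (eventually-× r+2d≈X r≈j)) (¬eventually-even (+ j) (at d))
    where open ≡-Reasoning
  ... | inj₂ r≥2 = minus r 2 r≥2 , trade-two r r≥2 (d +ᵖ d) X (sucᵖ d +ᵖ sucᵖ d) X
    (λ n → trans (cong (_+ at X n) (at-double-suc d n)) (swap (at (d +ᵖ d) n) (at X n))) r+2d≈X
    where
      swap : ∀ a x → a + + 2 + x ≡ a + x + + 2
      swap = solve-∀

  x+2y≡y⇒x+y≡0 : ∀ x y → x + (y + y) ≡ y → x + y ≡ 0ℤ
  x+2y≡y⇒x+y≡0 x y e = trans (regroup x y) (trans (cong (_- y) e) (ℤ.+-inverseʳ y))
    where
      regroup : ∀ x y → x + y ≡ x + (y + y) - y
      regroup = solve-∀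

  ¬double-X≤X : ¬ X +ᵖ X ≤ₘ X
  ¬double-X≤X (r , r+2X≈X) with eventually-witness (eventually-× r+2X≈X (nonNegative r))
  ... | suc m , _ , e , r≥0 = nonNegative+suc≢0 m r≥0 (subst (λ x → at r (suc m) + x ≡ 0ℤ) (at-X (suc m))
    (x+2y≡y⇒x+y≡0 (at r (suc m)) (at X (suc m))
      (trans (cong (_+_ (at r (suc m))) (sym (at-+ X X (suc m)))) (trans (sym (at-+ r (X +ᵖ X) (suc m))) e))))

  ℤ[X]⁺-refutes-I≤ : ¬ ⟦ indAx {1} (atom le (var fz ⊕ var fz) (var (fs fz))) ⟧ []ᵥ
  ℤ[X]⁺-refutes-I≤ induction = induction X (contradiction (X , X+0≈X) , λ d → ¬¬-map (double-≤-step d)) X ¬double-X≤X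
    where
      X+0≈X : X +ᵖ (zeroᵖ +ᵖ zeroᵖ) ≈ᵖ X
      X+0≈X = always λ n → trans (at-+ X (zeroᵖ +ᵖ zeroᵖ) n) (ℤ.+-identityʳ (at X n))

  X≤double-step : ∀ d → X ≤ₘ sucᵖ d +ᵖ sucᵖ d → X ≤ₘ d +ᵖ d
  X≤double-step d (r , r+X≈2Sd) with numeral-or-large r 2
  ... | inj₁ (j , r≈j) = contradiction (eventually-map (λ {n} (e , rₙ≡j) → begin
          + n                                  ≡⟨ cancel (+ j) (+ n) ⟩
          - + j + (+ j + + n)                  ≡⟨ cong (λ a → - + j + (a + + n)) (trans rₙ≡j (at-numeral j n)) ⟨
          - + j + (at r n + + n)               ≡⟨ cong (_+_ (- + j)) (trans (cong (_+_ (at r n)) (sym (at-X n))) (sym (at-+ r X n))) ⟩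
          - + j + at (r +ᵖ X) n                ≡⟨ cong (_+_ (- + j)) (trans e (at-+ (sucᵖ d) (sucᵖ d) n)) ⟩
          - + j + (at (sucᵖ d) n + at (sucᵖ d) n) ∎) (eventually-× r+X≈2Sd r≈j)) (¬eventually-even (- + j) (at (sucᵖ d)))
    where
      open ≡-Reasoning
      cancel : ∀ j n → n ≡ - j + (j + n)
      cancel = solve-∀
  ... | inj₂ r≥2 = minus r 2 r≥2 , trade-two r r≥2 X (sucᵖ d +ᵖ sucᵖ d) X (d +ᵖ d)
    (λ n → trans (cong (_+_ (at X n)) (at-double-suc d n)) (sym (ℤ.+-assoc (at X n) _ _))) r+X≈2Sd

  ¬X≤0 : ¬ X ≤ₘ zeroᵖ +ᵖ zeroᵖ
  ¬X≤0 (r , r+X≈0) with eventually-witness (eventually-× r+X≈0 (nonNegative r))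
  ... | suc m , _ , e , r≥0 = nonNegative+suc≢0 m r≥0
    (trans (cong (_+_ (at r (suc m))) (sym (at-X (suc m)))) (trans (sym (at-+ r X (suc m))) e))

  ℤ[X]⁺-refutes-I≰ : ¬ ⟦ indAx {1} (atom nle (var (fs fz)) (var fz ⊕ var fz)) ⟧ []ᵥ
  ℤ[X]⁺-refutes-I≰ induction = induction X
    (contradiction ¬X≤0 , λ d X≰2d → X≰2d ∘ ¬¬-map (X≤double-step d)) X (contradiction (X , ≈-refl {X +ᵖ X}))
open ℕ∞-Model using (ℕ∞-structure; ℕ∞-models-I=; ℕ∞-models-I≤; ℕ∞-refutes-I≠; ℕ∞-refutes-I≰)
open ℕ∞₂-Model using (ℕ∞₂-structure; ℕ∞₂-models-I≤; ℕ∞₂-refutes-I=)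
open ℤ[X]⁺-Model using (ℤ[X]⁺-structure; ℤ[X]⁺-models-I=; ℤ[X]⁺-models-I≠; ℤ[X]⁺-refutes-I≤; ℤ[X]⁺-refutes-I≰)

module ℕ∞   = Semantics.Interpretation ℕ∞-structure
module ℕ∞₂  = Semantics.Interpretation ℕ∞₂-structure
module ℤ[X]⁺ = Semantics.Interpretation ℤ[X]⁺-structure

theorem3p1 : ((I eq ⊬ᵀ I neq) × (I eq ⊬ᵀ I le) × (I eq ⊬ᵀ I nle)) × ((I neq ⊬ᵀ I le) × (I neq ⊬ᵀ I nle)) × ((I le ⊬ᵀ I eq) × (I le ⊬ᵀ I neq) × (I le ⊬ᵀ I nle))
theorem3p1 =
  ( ( ℕ∞.countermodel ℕ∞-models-I= (ind {n = 0} (var fz) (S (var fz))) ℕ∞-refutes-I≠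
    , ℤ[X]⁺.countermodel ℤ[X]⁺-models-I= (ind {n = 1} (var fz ⊕ var fz) (var (fs fz))) ℤ[X]⁺-refutes-I≤
    , ℕ∞.countermodel ℕ∞-models-I= (ind {n = 0} (S (var fz)) (var fz)) ℕ∞-refutes-I≰ )
  , ( ℤ[X]⁺.countermodel ℤ[X]⁺-models-I≠ (ind {n = 1} (var fz ⊕ var fz) (var (fs fz))) ℤ[X]⁺-refutes-I≤
    , ℤ[X]⁺.countermodel ℤ[X]⁺-models-I≠ (ind {n = 1} (var (fs fz)) (var fz ⊕ var fz)) ℤ[X]⁺-refutes-I≰ )
  , ( ℕ∞₂.countermodel ℕ∞₂-models-I≤ (ind {n = 0} (𝟘 ⊕ var fz) (var fz)) ℕ∞₂-refutes-I=
    , ℕ∞.countermodel ℕ∞-models-I≤ (ind {n = 0} (var fz) (S (var fz))) ℕ∞-refutes-I≠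
    , ℕ∞.countermodel ℕ∞-models-I≤ (ind {n = 0} (S (var fz)) (var fz)) ℕ∞-refutes-I≰ ) )
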